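{- Let $\mathbb{K}$ be a field and $n \in \mathbb{N}$. For each $i \in \{1,\ldots,n\}$ let $U_i$ be a finite subset of $\mathbb{K}$ and $S_i : U_i \to \mathbb{N}_0$ a multiset, and let $S = S_1 \times \cdots \times S_n$ be the multigrid with domain $U_1 \times \cdots \times U_n$. Let $f \in \mathbb{K}[x_1,\ldots,x_n]$ and let $\alpha = (\alpha_1,\ldots,\alpha_n)$, $\lambda = (\lambda_1,\ldots,\lambda_n) \in \mathbb{N}_0^n$. Assume each $S_i$ is $\lambda_i$-null. Let $\|S_i\| := \sum_{u \in U_i} S_i(u)$. Assume $\alpha_i < \|S_i\|$ for all $i$ and that $f$ contains the monomial $x_1^{\alpha_1}\cdots x_n^{\alpha_n}$. Assume further that for every monomial $x^\gamma$ appearing in $f$ with $\gamma \neq \alpha$ there is $i$ such that \[ \gamma_i \in [0, \alpha_i - 1] \cup [\alpha_i + 1, \|S_i\| - 1] \cup [\|S_i\|, \alpha_i + \lambda_i]. \] Then $f$ does not vanish on the multigrid $S$.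
   Context: For integers $a,b$, $[a,b] := \{x \in \mathbb{N}_0 \mid a \le x \le b\}$ (empty if $a>b$). A multiset is a map $T: U \to \mathbb{N}_0$ from a finite set $U$ (its domain). The multigrid $S = S_1 \times \cdots \times S_n$ is the map on $U_1 \times\cdots\times U_n$ with $S(u_1,\ldots,u_n) = (S_1(u_1),\ldots,S_n(u_n))$. A point $\mathbf{c} \in \mathbb{K}^n$ is a zero of $f$ with multiplicity vector $(m_1,\ldots,m_n)$ if $f(x_1+c_1,\ldots,x_n+c_n) \in \langle x_1^{m_1},\ldots,x_n^{m_n}\rangle$. $f$ vanishes on the multigrid $S$ if every $\mathbf{u} \in U_1\times\cdots\times U_n$ is a zero of $f$ with multiplicity vector $S(\mathbf{u})$. For $\lambda \in \mathbb{N}_0$, a univariate polynomial of degree $\nu$ is $\lambda$-lacunary if all coefficients of $x^k$ with $\nu-\lambda \le k < \nu$ vanish; the multiset $S_i$ is $\lambda_i$-null if $\prod_{u \in U_i}(x - u)^{S_i(u)}$ is $\lambda_i$-lacunary. -}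

module Defs where

open import Level using (Level; _⊔_; suc)
open import Algebra.Bundles using (CommutativeRing)
open import Data.Nat as ℕ using (ℕ; zero; _≤_; _<_)
import Data.Nat.Properties as ℕP
open import Data.Fin using (Fin)
open import Data.Vec using (Vec; []; _∷_; lookup; replicate; zipWith; tabulate)
open import Data.Vec.Properties using (≡-dec)
open import Data.List using (List; []; _∷_; _++_; concatMap; map; foldr; allFin)
open import Data.Product using (_×_; _,_; ∃; Σ)
open import Data.Sum using (_⊎_)
open import Relation.Nullary using (¬_; yes; no)
open import Relation.Binary.PropositionalEquality using (_≡_)

record Field (c ℓ : Level) : Set (Level.suc (c ⊔ ℓ)) where
  field
    commutativeRing : CommutativeRing c ℓ
  open CommutativeRing commutativeRing public
  field
    0≉1     : ¬ (0# ≈ 1#)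
    inverse : ∀ x → ¬ (x ≈ 0#) → ∃ λ y → x * y ≈ 1#

module FieldDefs {c ℓ : Level} (𝕂 : Field c ℓ) where
  open Field 𝕂

  K : Set c
  K = Carrier

  -- Polynomials in n variables over K, as finite lists of terms a·x^β
  -- (exponent vector β : Vec ℕ n).  Equal exponents may repeat; the
  -- coefficient of x^γ is the sum of all coefficients of terms with exponent γ.
  Poly : ℕ → Set c
  Poly n = List (K × Vec ℕ n)

  coeff : ∀ {n} → Poly n → Vec ℕ n → K
  coeff []             γ = 0#
  coeff ((a , β) ∷ ts) γ with ≡-dec ℕ._≟_ γ β
  ... | yes _ = a + coeff ts γ
  ... | no  _ = coeff ts γ

  _+P_ : ∀ {n} → Poly n → Poly n → Poly n
  f +P g = f ++ g

  _*P_ : ∀ {n} → Poly n → Poly n → Poly n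
  f *P g = concatMap (λ { (a , α) → map (λ { (b , β) → (a * b , zipWith ℕ._+_ α β) }) g }) f

  constP : ∀ {n} → K → Poly n
  constP {n} a = (a , replicate n 0) ∷ []

  varP : ∀ {n} → Fin n → Poly n
  varP {n} i = (1# , tabulate (λ j → unit i j)) ∷ []
    where
    unit : Fin n → Fin n → ℕ
    unit i j with Data.Fin._≟_ i j
    ... | yes _ = 1
    ... | no  _ = 0

  _^P_ : ∀ {n} → Poly n → ℕ → Poly n
  f ^P zero      = constP 1#
  f ^P (ℕ.suc k) = f *P (f ^P k)

  prodP : ∀ {n} → (Fin n → Poly n) → Poly n
  prodP {n} F = foldr (λ i acc → F i *P acc) (constP 1#) (allFin n)

  sumP : ∀ {n} → (Fin n → Poly n) → Poly n
  sumP {n} F = foldr (λ i acc → F i +P acc) [] (allFin n)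

  shift : ∀ {n} → Poly n → (Fin n → K) → Poly n
  shift {n} f c =
    foldr (λ { (a , β) acc → (constP a *P prodP (λ i → (varP i +P constP (c i)) ^P lookup β i)) +P acc })
          [] f

  InMonomialIdeal : ∀ {n} → (Fin n → ℕ) → Poly n → Set (c ⊔ ℓ)
  InMonomialIdeal {n} m h =
    Σ (Fin n → Poly n) λ g →
      ∀ γ → coeff h γ ≈ coeff (sumP (λ i → (varP i ^P m i) *P g i)) γ

  IsZeroWithMult : ∀ {n} → Poly n → (Fin n → K) → (Fin n → ℕ) → Set (c ⊔ ℓ)
  IsZeroWithMult f c m = InMonomialIdeal m (shift f c)

  -- A multiset T : U → ℕ₀ with U a finite subset of K, given by an injective
  -- enumeration of U.
  record Multiset : Set (c ⊔ ℓ) where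
    field
      size     : ℕ
      elem     : Fin size → K
      distinct : ∀ i j → elem i ≈ elem j → i ≡ j
      mult     : Fin size → ℕ
  open Multiset public

  ‖_‖ : Multiset → ℕ
  ‖ T ‖ = foldr (λ i acc → mult T i ℕ.+ acc) 0 (allFin (size T))

  VanishesOn : ∀ {n} → Poly n → (Fin n → Multiset) → Set (c ⊔ ℓ)
  VanishesOn {n} f S =
    (u : (i : Fin n) → Fin (size (S i))) →
    IsZeroWithMult f (λ i → elem (S i) (u i)) (λ i → mult (S i) (u i))

  coeff₁ : Poly 1 → ℕ → K
  coeff₁ p k = coeff p (k ∷ [])

  HasDegree : Poly 1 → ℕ → Set ℓ
  HasDegree p ν = ¬ (coeff₁ p ν ≈ 0#) × (∀ k → ν < k → coeff₁ p k ≈ 0#)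

  Lacunary : ℕ → Poly 1 → Set ℓ
  Lacunary λ' p = ∀ ν → HasDegree p ν → ∀ k → ν ℕ.∸ λ' ≤ k → k < ν → coeff₁ p k ≈ 0#

  nodePoly : Multiset → Poly 1
  nodePoly T = foldr (λ i acc → ((varP Fin.zero +P constP (- elem T i)) ^P mult T i) *P acc)
                     (constP 1#) (allFin (size T))
    where import Data.Fin as Fin

  IsNull : ℕ → Multiset → Set ℓ
  IsNull λ' T = Lacunary λ' (nodePoly T)

  Appears : ∀ {n} → Poly n → Vec ℕ n → Set ℓ
  Appears f γ = ¬ (coeff f γ ≈ 0#)

  _∈[_,_] : ℕ → ℕ → ℕ → Set
  x ∈[ a , b ] = a ≤ x × x ≤ b

{-# OPTIONS --safe #-}
-- A sequence ψ : ℕ → K is a linear functional on K[x] (x^e ↦ ψ e), and a product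
-- of such sequences is one on K[x₁,…,xₙ].  Vanishing of f at u with multiplicity S(u) says that
-- f is killed by the Hasse-derivative functionals at u of orders below S(u).  For each i let φᵢ
-- agree with the indicator of αᵢ below ‖Sᵢ‖ and satisfy the linear recurrence of the node
-- polynomial Nᵢ = ∏ᵤ (x - u)^{Sᵢ(u)}; then φᵢ kills the ideal (Nᵢ), and λᵢ-lacunarity of Nᵢ
-- makes φᵢ vanish on [‖Sᵢ‖, αᵢ + λᵢ] as well.  A univariate polynomial killed by all Hasse
-- functionals of Sᵢ is divisible by Nᵢ, hence killed by φᵢ; replacing one coordinate at a time
-- shows that φ₁ ⊗ ⋯ ⊗ φₙ kills f.  But this functional is 1 on x^α and 0 on every other
-- monomial of f, so the coefficient of x^α vanishes.

module Submission where

open import Defs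
open import Level using (Level)
open import Function using (_∘_; _$_; id; const)
open import Data.Nat as ℕ using (ℕ; zero; suc; _≤_; _<_; z≤n; s≤s)
import Data.Nat.Properties as ℕP
import Data.Nat.Induction as ℕI
import Induction.WellFounded as WF
open import Data.Fin as Fin using (Fin; toℕ; fromℕ<; punchIn)
import Data.Fin.Properties as FinP
open import Data.Vec as Vec using (Vec; []; _∷_; lookup; zipWith; replicate; tabulate)
open import Data.Vec.Properties using (≡-dec)
import Data.Vec.Properties as VecP
open import Data.Vec.Functional using (updateAt; removeAt)
import Data.Vec.Functional.Properties as VectorP
open import Data.List using (List; []; _∷_; _++_; map; foldr; allFin)
open import Data.List.Relation.Unary.All as All using (All; []; _∷_)
open import Data.List.Relation.Unary.All.Properties using (++⁺; map⁺)
open import Data.List.Relation.Unary.Unique.Propositional using (Unique)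
open import Data.List.Relation.Unary.Unique.Propositional.Properties using (allFin⁺)
open import Data.List.Relation.Unary.AllPairs using ([]; _∷_)
open import Data.List.Relation.Unary.Any using (here; there)
open import Data.List.Membership.Propositional using (_∈_)
open import Data.List.Membership.Propositional.Properties using (∈-allFin)
open import Data.Product using (Σ; _×_; _,_; ∃; ∃₂; proj₁; proj₂)
open import Data.Sum using (_⊎_; inj₁; inj₂; [_,_]′)
open import Data.Unit using (⊤; tt)
open import Relation.Nullary using (¬_; Dec; yes; no)
open import Relation.Nullary.Negation using (contradiction; ¬¬-map; ¬¬-Monad)
open import Relation.Nullary.Decidable using (¬¬-excluded-middle)
open import Effect.Monad using (RawMonad)
open import Relation.Binary.Definitions using (DecidableEquality)
open import Relation.Binary.PropositionalEquality as P using (_≡_; _≢_)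

module Duality {c ℓ : Level} (𝕂 : Field c ℓ) where
  open Field 𝕂 hiding (zero)
  open FieldDefs 𝕂
  open import Algebra.Properties.Ring ring using (-0#≈0#; +-inverseʳ-unique; x∙y⁻¹≈ε⇒x≈y)
  open import Algebra.Properties.CommutativeMonoid.Sum +-commutativeMonoid
    using (sum-syntax; sum-cong-≋; sum-cong-≗; sum-remove; sum-replicate-zero; sum-init-last; ∑-distrib-+)
  open import Algebra.Properties.CommutativeMonoid.Sum *-commutativeMonoid as Product
    using () renaming (sum to ∏)
  open import Relation.Binary.Reasoning.Setoid setoid
  open import Algebra.Solver.Ring.NaturalCoefficients.Default commutativeSemiring
    using (solve; _:=_; _:+_; _:*_)

  x*y≈0⇒y≈0 : ∀ {x y} → ¬ (x ≈ 0#) → x * y ≈ 0# → y ≈ 0#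
  x*y≈0⇒y≈0 {x} {y} x≉0 xy≈0 with inverse x x≉0
  ... | x⁻¹ , xx⁻¹≈1 = begin
    y                ≈⟨ *-identityˡ y ⟨
    1# * y           ≈⟨ *-congʳ xx⁻¹≈1 ⟨
    (x * x⁻¹) * y    ≈⟨ solve 3 (λ x x⁻¹ y → (x :* x⁻¹) :* y := x⁻¹ :* (x :* y)) refl x x⁻¹ y ⟩
    x⁻¹ * (x * y)    ≈⟨ *-congˡ xy≈0 ⟩
    x⁻¹ * 0#         ≈⟨ zeroʳ x⁻¹ ⟩
    0#               ∎

  ∑-cong : ∀ {m} (f g : Fin m → K) → (∀ j → f j ≈ g j) → ∑[ j < m ] f j ≈ ∑[ j < m ] g j
  ∑-cong {m} f g = sum-cong-≋ {m} {f} {g}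

  ∑≈0 : ∀ {m} (f : Fin m → K) → (∀ j → f j ≈ 0#) → ∑[ j < m ] f j ≈ 0#
  ∑≈0 {m} f f≈0 = trans (∑-cong f _ f≈0) (sum-replicate-zero m)

  ∑-single : ∀ {m} (f : Fin m → K) i → (∀ j → j ≢ i → f j ≈ 0#) → ∑[ j < m ] f j ≈ f i
  ∑-single {suc m} f i f≈0 = begin
    ∑[ j < suc m ] f j                ≈⟨ sum-remove {i = i} f ⟩
    f i + ∑[ j < m ] f (punchIn i j)  ≈⟨ +-congˡ (∑≈0 _ (λ j → f≈0 (punchIn i j) (FinP.punchInᵢ≢i i j))) ⟩
    f i + 0#                          ≈⟨ +-identityʳ (f i) ⟩
    f i                               ∎

  Seq : Set c
  Seq = ℕ → K

  Weight : ℕ → Set c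
  Weight n = Vec ℕ n → K

  infix 4 _≐_
  _≐_ : ∀ {A : Set} → (A → K) → (A → K) → Set ℓ
  v ≐ w = ∀ x → v x ≈ w x

  δ : ∀ {A : Set} → DecidableEquality A → A → A → K
  δ _≟_ x y with x ≟ y
  ... | yes _ = 1#
  ... | no  _ = 0#

  δ-≡ : ∀ {A : Set} (_≟_ : DecidableEquality A) x y → x ≡ y → δ _≟_ x y ≈ 1#
  δ-≡ _≟_ x y x≡y with x ≟ y
  ... | yes _   = refl
  ... | no  x≢y = contradiction x≡y x≢y

  δ-≢ : ∀ {A : Set} (_≟_ : DecidableEquality A) x y → x ≢ y → δ _≟_ x y ≈ 0#
  δ-≢ _≟_ x y x≢y with x ≟ y
  ... | yes x≡y = contradiction x≡y x≢y
  ... | no  _   = refl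

  -- Pairing term lists with weights

  ⟪_∣_⟫ : ∀ {A : Set} → List (K × A) → (A → K) → K
  ⟪ []          ∣ w ⟫ = 0#
  ⟪ (a , x) ∷ p ∣ w ⟫ = a * w x + ⟪ p ∣ w ⟫

  module _ {A : Set} where

    ⟪⟫-++ : ∀ (p q : List (K × A)) w → ⟪ p ++ q ∣ w ⟫ ≈ ⟪ p ∣ w ⟫ + ⟪ q ∣ w ⟫
    ⟪⟫-++ []            q w = sym (+-identityˡ _)
    ⟪⟫-++ ((a , x) ∷ p) q w = trans (+-congˡ (⟪⟫-++ p q w)) (sym (+-assoc _ _ _))

    ⟪⟫-cong : ∀ (p : List (K × A)) {v w} → v ≐ w → ⟪ p ∣ v ⟫ ≈ ⟪ p ∣ w ⟫
    ⟪⟫-cong []            v≐w = refl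
    ⟪⟫-cong ((a , x) ∷ p) v≐w = +-cong (*-congˡ (v≐w x)) (⟪⟫-cong p v≐w)

    ⟪⟫≈0 : ∀ (p : List (K × A)) {w} → All (λ t → w (proj₂ t) ≈ 0#) p → ⟪ p ∣ w ⟫ ≈ 0#
    ⟪⟫≈0 []            []           = refl
    ⟪⟫≈0 ((a , x) ∷ p) (wx≈0 ∷ w≈0) =
      trans (+-cong (trans (*-congˡ wx≈0) (zeroʳ a)) (⟪⟫≈0 p w≈0)) (+-identityˡ 0#)

    ⟪⟫-*ˡ : ∀ (p : List (K × A)) a w → ⟪ p ∣ (λ x → a * w x) ⟫ ≈ a * ⟪ p ∣ w ⟫
    ⟪⟫-*ˡ []            a w = sym (zeroʳ a)
    ⟪⟫-*ˡ ((b , x) ∷ p) a w = begin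
      b * (a * w x) + ⟪ p ∣ (λ x → a * w x) ⟫  ≈⟨ +-congˡ (⟪⟫-*ˡ p a w) ⟩
      b * (a * w x) + a * ⟪ p ∣ w ⟫            ≈⟨ solve 4 (λ a b wx s → b :* (a :* wx) :+ a :* s
                                                                  := a :* (b :* wx :+ s))
                                                          refl a b (w x) ⟪ p ∣ w ⟫ ⟩
      a * (b * w x + ⟪ p ∣ w ⟫)                ∎

    ⟪⟫-+ : ∀ (p : List (K × A)) v w → ⟪ p ∣ (λ x → v x + w x) ⟫ ≈ ⟪ p ∣ v ⟫ + ⟪ p ∣ w ⟫
    ⟪⟫-+ []            v w = sym (+-identityˡ 0#)
    ⟪⟫-+ ((b , x) ∷ p) v w = begin
      b * (v x + w x) + ⟪ p ∣ (λ x → v x + w x) ⟫  ≈⟨ +-congˡ (⟪⟫-+ p v w) ⟩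
      b * (v x + w x) + (⟪ p ∣ v ⟫ + ⟪ p ∣ w ⟫)      ≈⟨ solve 5 (λ b vx wx s t → b :* (vx :+ wx) :+ (s :+ t)
                                                                   := (b :* vx :+ s) :+ (b :* wx :+ t))
                                                           refl b (v x) (w x) ⟪ p ∣ v ⟫ ⟪ p ∣ w ⟫ ⟩
      (b * v x + ⟪ p ∣ v ⟫) + (b * w x + ⟪ p ∣ w ⟫)  ∎

    ⟪⟫-map : ∀ {B : Set} (p : List (K × A)) (g : A → K) (h : A → B) (w : B → K) →
             ⟪ map (λ t → (g (proj₂ t) * proj₁ t , h (proj₂ t))) p ∣ w ⟫ ≈ ⟪ p ∣ (λ x → g x * w (h x)) ⟫
    ⟪⟫-map []            g h w = refl
    ⟪⟫-map ((a , x) ∷ p) g h w =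
      +-cong (solve 3 (λ a gx wx → (gx :* a) :* wx := a :* (gx :* wx)) refl a (g x) (w (h x)))
             (⟪⟫-map p g h w)

    scale : K → List (K × A) → List (K × A)
    scale a = map (λ t → (a * proj₁ t , proj₂ t))

    ⟪⟫-scale : ∀ a (p : List (K × A)) w → ⟪ scale a p ∣ w ⟫ ≈ a * ⟪ p ∣ w ⟫
    ⟪⟫-scale a p w = trans (⟪⟫-map p (const a) id w) (⟪⟫-*ˡ p a w)

  infixl 6 _⊹_
  _⊹_ : ∀ {n} → Vec ℕ n → Vec ℕ n → Vec ℕ n
  _⊹_ = zipWith ℕ._+_

  0⃗ : ∀ {n} → Vec ℕ n
  0⃗ {n} = replicate n 0

  ⊹-identityˡ : ∀ {n} (β : Vec ℕ n) → 0⃗ ⊹ β ≡ β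
  ⊹-identityˡ = VecP.zipWith-identityˡ ℕP.+-identityˡ

  ⊹-identityʳ : ∀ {n} (β : Vec ℕ n) → β ⊹ 0⃗ ≡ β
  ⊹-identityʳ = VecP.zipWith-identityʳ ℕP.+-identityʳ

  ⊹-rotate : ∀ {n} (α α′ β : Vec ℕ n) → α ⊹ α′ ⊹ β ≡ α′ ⊹ (α ⊹ β)
  ⊹-rotate α α′ β = P.trans (P.cong (_⊹ β) (VecP.zipWith-comm ℕP.+-comm α α′))
                            (VecP.zipWith-assoc ℕP.+-assoc α′ α β)

  lookup-⊹ : ∀ {n} (α β : Vec ℕ n) i → lookup (α ⊹ β) i ≡ lookup α i ℕ.+ lookup β i
  lookup-⊹ α β i = VecP.lookup-zipWith ℕ._+_ i α β

  -- varP i is (1# , tabulate (𝟙 i)) ∷ [], where 𝟙 i is the where-bound helper of varP in Defs,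
  -- recovered here by unification.
  𝟙 : ∀ {n} → Fin n → Fin n → ℕ
  𝟙 {n} i = proj₁ indicator
    where
    indicator : Σ (Fin n → ℕ) λ f → varP i ≡ (1# , tabulate f) ∷ []
    indicator = _ , P.refl

  𝐞 : ∀ {n} → Fin n → Vec ℕ n
  𝐞 i = tabulate (𝟙 i)

  lookup-𝐞-same : ∀ {n} (i : Fin n) → lookup (𝐞 i) i ≡ 1
  lookup-𝐞-same i = P.trans (VecP.lookup∘tabulate (𝟙 i) i) 𝟙-same
    where
    𝟙-same : 𝟙 i i ≡ 1
    𝟙-same with i Fin.≟ i
    ... | yes _   = P.refl
    ... | no  i≢i = contradiction P.refl i≢i

  lookup-𝐞-other : ∀ {n} (i j : Fin n) → i ≢ j → lookup (𝐞 i) j ≡ 0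
  lookup-𝐞-other i j i≢j = P.trans (VecP.lookup∘tabulate (𝟙 i) j) 𝟙-other
    where
    𝟙-other : 𝟙 i j ≡ 0
    𝟙-other with i Fin.≟ j
    ... | yes i≡j = contradiction i≡j i≢j
    ... | no  _   = P.refl

  lookup-𝐞⊹-same : ∀ {n} (i : Fin n) β → lookup (𝐞 i ⊹ β) i ≡ suc (lookup β i)
  lookup-𝐞⊹-same i β = P.trans (lookup-⊹ (𝐞 i) β i) (P.cong (ℕ._+ lookup β i) (lookup-𝐞-same i))

  lookup-𝐞⊹-other : ∀ {n} (i j : Fin n) β → j ≢ i → lookup (𝐞 i ⊹ β) j ≡ lookup β j
  lookup-𝐞⊹-other i j β j≢i =
    P.trans (lookup-⊹ (𝐞 i) β j) (P.cong (ℕ._+ lookup β j) (lookup-𝐞-other i j (j≢i ∘ P.sym)))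

  coeff≈⟪δ⟫ : ∀ {n} (p : Poly n) γ → coeff p γ ≈ ⟪ p ∣ δ (≡-dec ℕ._≟_) γ ⟫
  coeff≈⟪δ⟫ []            γ = refl
  coeff≈⟪δ⟫ ((a , β) ∷ p) γ with ≡-dec ℕ._≟_ γ β
  ... | yes _ = +-cong (sym (*-identityʳ a)) (coeff≈⟪δ⟫ p γ)
  ... | no  _ = trans (coeff≈⟪δ⟫ p γ) (sym (trans (+-congʳ (zeroʳ a)) (+-identityˡ _)))

  coeff-∷ : ∀ {n} a β (p : Poly n) γ → coeff ((a , β) ∷ p) γ ≈ δ (≡-dec ℕ._≟_) γ β * a + coeff p γ
  coeff-∷ a β p γ with ≡-dec ℕ._≟_ γ β
  ... | yes _ = +-congʳ (sym (*-identityˡ a))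
  ... | no  _ = sym (trans (+-congʳ (zeroˡ a)) (+-identityˡ _))

  ⟪⟫-*P : ∀ {n} (p q : Poly n) W → ⟪ p *P q ∣ W ⟫ ≈ ⟪ p ∣ (λ α → ⟪ q ∣ (λ β → W (α ⊹ β)) ⟫) ⟫
  ⟪⟫-*P []            q W = refl
  ⟪⟫-*P ((a , α) ∷ p) q W = begin
    ⟪ map (λ t → (a * proj₁ t , α ⊹ proj₂ t)) q ++ p *P q ∣ W ⟫
      ≈⟨ ⟪⟫-++ (map (λ t → (a * proj₁ t , α ⊹ proj₂ t)) q) (p *P q) W ⟩
    ⟪ map (λ t → (a * proj₁ t , α ⊹ proj₂ t)) q ∣ W ⟫ + ⟪ p *P q ∣ W ⟫
      ≈⟨ +-cong (trans (⟪⟫-map q (const a) (α ⊹_) W) (⟪⟫-*ˡ q a (λ β → W (α ⊹ β)))) (⟪⟫-*P p q W) ⟩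
    a * ⟪ q ∣ (λ β → W (α ⊹ β)) ⟫ + ⟪ p ∣ (λ α → ⟪ q ∣ (λ β → W (α ⊹ β)) ⟫) ⟫
      ∎

  linear : ∀ {n} → Fin n → K → Poly n
  linear i c = varP i +P constP c

  -- Transpose of multiplication: ⟪ q ∣ p ▹ W ⟫ = ⟪ p *P q ∣ W ⟫.
  infixr 5 _▹_
  _▹_ : ∀ {n} → Poly n → Weight n → Weight n
  (p ▹ W) β = ⟪ p ∣ (λ α → W (α ⊹ β)) ⟫

  module _ {n : ℕ} where

    ▹-cong : ∀ (p : Poly n) {V W} → V ≐ W → p ▹ V ≐ p ▹ W
    ▹-cong p V≐W β = ⟪⟫-cong p (λ α → V≐W (α ⊹ β))

    ▹-+P : ∀ (p q : Poly n) W → p +P q ▹ W ≐ λ β → (p ▹ W) β + (q ▹ W) β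
    ▹-+P p q W β = ⟪⟫-++ p q _

    ▹-*P : ∀ (p q : Poly n) W → p *P q ▹ W ≐ p ▹ q ▹ W
    ▹-*P p q W β = trans (⟪⟫-*P p q _)
      (⟪⟫-cong p (λ α → ⟪⟫-cong q (λ α′ → reflexive (P.cong W (⊹-rotate α α′ β)))))

    ▹-constP : ∀ a W → constP {n} a ▹ W ≐ λ β → a * W β
    ▹-constP a W β = trans (+-identityʳ _) (*-congˡ (reflexive (P.cong W (⊹-identityˡ β))))

    ▹-varP : ∀ (i : Fin n) W → varP i ▹ W ≐ λ β → W (𝐞 i ⊹ β)
    ▹-varP i W β = trans (+-identityʳ _) (*-identityˡ _)

    ▹-linear : ∀ (i : Fin n) c W → linear i c ▹ W ≐ λ β → W (𝐞 i ⊹ β) + c * W β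
    ▹-linear i c W β = trans (▹-+P (varP i) (constP c) W β) (+-cong (▹-varP i W β) (▹-constP c W β))

  -- Sequences and the action of univariate polynomials

  X+ : K → Seq → Seq
  X+ c ψ e = ψ (suc e) + c * ψ e

  X+^ : K → ℕ → Seq → Seq
  X+^ c zero    ψ = ψ
  X+^ c (suc m) ψ = X+ c (X+^ c m ψ)

  nodeOp : (T : Multiset) → List (Fin (size T)) → Seq → Seq
  nodeOp T I ψ = foldr (λ i → X+^ (- elem T i) (mult T i)) ψ I

  X+-cong : ∀ c {φ ψ} → φ ≐ ψ → X+ c φ ≐ X+ c ψ
  X+-cong c φ≐ψ e = +-cong (φ≐ψ (suc e)) (*-congˡ (φ≐ψ e))

  X+^-cong : ∀ c m {φ ψ} → φ ≐ ψ → X+^ c m φ ≐ X+^ c m ψ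
  X+^-cong c zero    φ≐ψ = φ≐ψ
  X+^-cong c (suc m) φ≐ψ = X+-cong c (X+^-cong c m φ≐ψ)

  nodeOp-cong : ∀ T I {φ ψ} → φ ≐ ψ → nodeOp T I φ ≐ nodeOp T I ψ
  nodeOp-cong T []      φ≐ψ = φ≐ψ
  nodeOp-cong T (i ∷ I) φ≐ψ = X+^-cong (- elem T i) (mult T i) (nodeOp-cong T I φ≐ψ)

  X+-comm : ∀ c d ψ → X+ c (X+ d ψ) ≐ X+ d (X+ c ψ)
  X+-comm c d ψ e = solve 5 (λ c d x y z → (x :+ d :* y) :+ c :* (y :+ d :* z)
                                         := (x :+ c :* y) :+ d :* (y :+ c :* z))
                      refl c d (ψ (suc (suc e))) (ψ (suc e)) (ψ e)

  X+^-X+-comm : ∀ c m d ψ → X+^ c m (X+ d ψ) ≐ X+ d (X+^ c m ψ)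
  X+^-X+-comm c zero    d ψ e = refl
  X+^-X+-comm c (suc m) d ψ e = trans (X+-cong c (X+^-X+-comm c m d ψ) e) (X+-comm c d (X+^ c m ψ) e)

  nodeOp-X+-comm : ∀ T I d ψ → nodeOp T I (X+ d ψ) ≐ X+ d (nodeOp T I ψ)
  nodeOp-X+-comm T []      d ψ e = refl
  nodeOp-X+-comm T (i ∷ I) d ψ e = trans (X+^-cong (- elem T i) (mult T i) (nodeOp-X+-comm T I d ψ) e)
                                         (X+^-X+-comm (- elem T i) (mult T i) d (nodeOp T I ψ) e)

  -- hasse c j e = C(e, j) c^(e ∸ j), the j-th Hasse derivative of x^e at c.
  hasse : K → ℕ → Seq
  hasse c zero    zero    = 1#
  hasse c (suc j) zero    = 0#
  hasse c zero    (suc e) = c * hasse c zero e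
  hasse c (suc j) (suc e) = c * hasse c (suc j) e + hasse c j e

  X+-hasse-zero : ∀ r w → X+ (- r) (hasse w zero) ≐ λ e → (w - r) * hasse w zero e
  X+-hasse-zero r w e = solve 3 (λ w -r h → w :* h :+ -r :* h := (w :+ -r) :* h)
                          refl w (- r) (hasse w zero e)

  X+-hasse-suc : ∀ r w j →
                 X+ (- r) (hasse w (suc j)) ≐ λ e → (w - r) * hasse w (suc j) e + hasse w j e
  X+-hasse-suc r w j e = solve 4 (λ w -r h h′ → (w :* h :+ h′) :+ -r :* h := (w :+ -r) :* h :+ h′)
                           refl w (- r) (hasse w (suc j) e) (hasse w j e)

  X+^-δ-below : ∀ c e j x → j < x → X+^ c e (δ ℕ._≟_ j) x ≈ 0#
  X+^-δ-below c zero    j x j<x = δ-≢ ℕ._≟_ j x (ℕP.<⇒≢ j<x)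
  X+^-δ-below c (suc e) j x j<x = begin
    X+^ c e (δ ℕ._≟_ j) (suc x) + c * X+^ c e (δ ℕ._≟_ j) x
      ≈⟨ +-cong (X+^-δ-below c e j (suc x) (ℕP.m<n⇒m<1+n j<x))
                (*-congˡ (X+^-δ-below c e j x j<x)) ⟩
    0# + c * 0#  ≈⟨ trans (+-identityˡ _) (zeroʳ c) ⟩
    0#           ∎

  X+^-δ : ∀ c e x t → X+^ c e (δ ℕ._≟_ (x ℕ.+ t)) x ≈ hasse c t e
  X+^-δ c zero    x zero    = δ-≡ ℕ._≟_ (x ℕ.+ 0) x (ℕP.+-identityʳ x)
  X+^-δ c zero    x (suc t) = δ-≢ ℕ._≟_ (x ℕ.+ suc t) x (ℕP.m+1+n≢m x)
  X+^-δ c (suc e) x zero    = begin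
    X+^ c e (δ ℕ._≟_ (x ℕ.+ 0)) (suc x) + c * X+^ c e (δ ℕ._≟_ (x ℕ.+ 0)) x
      ≈⟨ +-cong (X+^-δ-below c e (x ℕ.+ 0) (suc x) (s≤s (ℕP.≤-reflexive (ℕP.+-identityʳ x))))
                (*-congˡ (X+^-δ c e x zero)) ⟩
    0# + c * hasse c zero e  ≈⟨ +-identityˡ _ ⟩
    c * hasse c zero e       ∎
  X+^-δ c (suc e) x (suc t) = begin
    X+^ c e (δ ℕ._≟_ (x ℕ.+ suc t)) (suc x) + c * X+^ c e (δ ℕ._≟_ (x ℕ.+ suc t)) x
      ≈⟨ +-cong (reflexive (P.cong (λ j → X+^ c e (δ ℕ._≟_ j) (suc x)) (ℕP.+-suc x t))) refl ⟩
    X+^ c e (δ ℕ._≟_ (suc x ℕ.+ t)) (suc x) + c * X+^ c e (δ ℕ._≟_ (x ℕ.+ suc t)) x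
      ≈⟨ +-cong (X+^-δ c e (suc x) t) (*-congˡ (X+^-δ c e x (suc t))) ⟩
    hasse c t e + c * hasse c (suc t) e  ≈⟨ +-comm _ _ ⟩
    c * hasse c (suc t) e + hasse c t e  ∎

  infixr 5 _▸_
  _▸_ : Poly 1 → Seq → Seq
  (p ▸ ψ) e = (p ▹ ψ ∘ Vec.head) (e ∷ [])

  ▸-*P : ∀ p q ψ → p *P q ▸ ψ ≐ p ▸ q ▸ ψ
  ▸-*P p q ψ e = trans (▹-*P p q (ψ ∘ Vec.head) (e ∷ []))
                       (▹-cong p {q ▹ ψ ∘ Vec.head} {(q ▸ ψ) ∘ Vec.head} (λ { (b ∷ []) → refl }) (e ∷ []))

  ▸-constP : ∀ a ψ → constP a ▸ ψ ≐ λ e → a * ψ e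
  ▸-constP a ψ e = ▹-constP a (ψ ∘ Vec.head) (e ∷ [])

  ▸-linear : ∀ c ψ → linear Fin.zero c ▸ ψ ≐ X+ c ψ
  ▸-linear c ψ e = ▹-linear Fin.zero c (ψ ∘ Vec.head) (e ∷ [])

  ▸-^P : ∀ c m ψ → (linear Fin.zero c) ^P m ▸ ψ ≐ X+^ c m ψ
  ▸-^P c zero    ψ e = trans (▸-constP 1# ψ e) (*-identityˡ _)
  ▸-^P c (suc m) ψ e = begin
    ((linear Fin.zero c) *P ((linear Fin.zero c) ^P m) ▸ ψ) e
      ≈⟨ ▸-*P (linear Fin.zero c) ((linear Fin.zero c) ^P m) ψ e ⟩
    (linear Fin.zero c ▸ (linear Fin.zero c) ^P m ▸ ψ) e
      ≈⟨ ▸-linear c ((linear Fin.zero c) ^P m ▸ ψ) e ⟩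
    X+ c ((linear Fin.zero c) ^P m ▸ ψ) e
      ≈⟨ X+-cong c (▸-^P c m ψ) e ⟩
    X+^ c (suc m) ψ e ∎

  nodePolyOver : (T : Multiset) → List (Fin (size T)) → Poly 1
  nodePolyOver T = foldr (λ i acc → ((linear Fin.zero (- elem T i)) ^P mult T i) *P acc) (constP 1#)

  ▸-nodePolyOver : ∀ T I ψ → nodePolyOver T I ▸ ψ ≐ nodeOp T I ψ
  ▸-nodePolyOver T []      ψ e = trans (▸-constP 1# ψ e) (*-identityˡ _)
  ▸-nodePolyOver T (i ∷ I) ψ e = begin
    (((linear Fin.zero (- elem T i)) ^P mult T i) *P nodePolyOver T I ▸ ψ) e
      ≈⟨ ▸-*P ((linear Fin.zero (- elem T i)) ^P mult T i) (nodePolyOver T I) ψ e ⟩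
    ((linear Fin.zero (- elem T i)) ^P mult T i ▸ nodePolyOver T I ▸ ψ) e
      ≈⟨ ▸-^P (- elem T i) (mult T i) (nodePolyOver T I ▸ ψ) e ⟩
    X+^ (- elem T i) (mult T i) (nodePolyOver T I ▸ ψ) e
      ≈⟨ X+^-cong (- elem T i) (mult T i) (▸-nodePolyOver T I ψ) e ⟩
    nodeOp T (i ∷ I) ψ e ∎

  -- Division by linear factors

  -- x^e = (x - r) * monomial÷ r e + r^e.
  monomial÷ : K → ℕ → List (K × ℕ)
  monomial÷ r zero    = []
  monomial÷ r (suc e) = (1# , e) ∷ scale r (monomial÷ r e)

  infixl 7 _÷_
  _÷_ : List (K × ℕ) → K → List (K × ℕ)
  []            ÷ r = []
  ((a , e) ∷ H) ÷ r = scale a (monomial÷ r e) ++ H ÷ r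

  monomial÷-identity : ∀ r e ψ → ψ e ≈ hasse r zero e * ψ 0 + ⟪ monomial÷ r e ∣ X+ (- r) ψ ⟫
  monomial÷-identity r zero    ψ = sym (trans (+-identityʳ _) (*-identityˡ _))
  monomial÷-identity r (suc e) ψ = sym (begin
    (r * h) * ψ 0 + (1# * X+ (- r) ψ e + ⟪ scale r (monomial÷ r e) ∣ X+ (- r) ψ ⟫)
      ≈⟨ +-congˡ (+-cong (*-identityˡ _) (⟪⟫-scale r (monomial÷ r e) (X+ (- r) ψ))) ⟩
    (r * h) * ψ 0 + ((ψ (suc e) + - r * ψ e) + r * Q)
      ≈⟨ +-congˡ (+-congʳ (+-congˡ (*-congˡ (monomial÷-identity r e ψ)))) ⟩
    (r * h) * ψ 0 + ((ψ (suc e) + - r * (h * ψ 0 + Q)) + r * Q)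
      ≈⟨ solve 6 (λ r -r h ψ₀ ψ₁ Q → (r :* h) :* ψ₀ :+ ((ψ₁ :+ -r :* (h :* ψ₀ :+ Q)) :+ r :* Q)
                                      := ψ₁ :+ (r :+ -r) :* (h :* ψ₀ :+ Q))
           refl r (- r) h (ψ 0) (ψ (suc e)) Q ⟩
    ψ (suc e) + (r - r) * (h * ψ 0 + Q)
      ≈⟨ +-congˡ (trans (*-congʳ (-‿inverseʳ r)) (zeroˡ _)) ⟩
    ψ (suc e) + 0#  ≈⟨ +-identityʳ _ ⟩
    ψ (suc e)       ∎)
    where
    h Q : K
    h = hasse r zero e
    Q = ⟪ monomial÷ r e ∣ X+ (- r) ψ ⟫

  ÷-identity : ∀ r H ψ → ⟪ H ∣ ψ ⟫ ≈ ⟪ H ∣ hasse r zero ⟫ * ψ 0 + ⟪ H ÷ r ∣ X+ (- r) ψ ⟫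
  ÷-identity r []            ψ = sym (trans (+-identityʳ _) (zeroˡ _))
  ÷-identity r ((a , e) ∷ H) ψ = begin
    a * ψ e + ⟪ H ∣ ψ ⟫
      ≈⟨ +-cong (*-congˡ (monomial÷-identity r e ψ)) (÷-identity r H ψ) ⟩
    a * (h * ψ 0 + Q) + (⟪ H ∣ hasse r zero ⟫ * ψ 0 + ⟪ H ÷ r ∣ X+ (- r) ψ ⟫)
      ≈⟨ solve 6 (λ a h ψ₀ Q G R → a :* (h :* ψ₀ :+ Q) :+ (G :* ψ₀ :+ R)
                                    := (a :* h :+ G) :* ψ₀ :+ (a :* Q :+ R))
           refl a h (ψ 0) Q ⟪ H ∣ hasse r zero ⟫ ⟪ H ÷ r ∣ X+ (- r) ψ ⟫ ⟩
    (a * h + ⟪ H ∣ hasse r zero ⟫) * ψ 0 + (a * Q + ⟪ H ÷ r ∣ X+ (- r) ψ ⟫)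
      ≈⟨ +-congˡ (+-congʳ (⟪⟫-scale a (monomial÷ r e) (X+ (- r) ψ))) ⟨
    (a * h + ⟪ H ∣ hasse r zero ⟫) * ψ 0
      + (⟪ scale a (monomial÷ r e) ∣ X+ (- r) ψ ⟫ + ⟪ H ÷ r ∣ X+ (- r) ψ ⟫)
      ≈⟨ +-congˡ (⟪⟫-++ (scale a (monomial÷ r e)) (H ÷ r) (X+ (- r) ψ)) ⟨
    (a * h + ⟪ H ∣ hasse r zero ⟫) * ψ 0 + ⟪ ((a , e) ∷ H) ÷ r ∣ X+ (- r) ψ ⟫
      ∎
    where
    h Q : K
    h = hasse r zero e
    Q = ⟪ monomial÷ r e ∣ X+ (- r) ψ ⟫

  ÷-adjoint : ∀ {r} H → ⟪ H ∣ hasse r zero ⟫ ≈ 0# → ∀ ψ → ⟪ H ∣ ψ ⟫ ≈ ⟪ H ÷ r ∣ X+ (- r) ψ ⟫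
  ÷-adjoint {r} H H[r]≈0 ψ =
    trans (÷-identity r H ψ) (trans (+-congʳ (trans (*-congʳ H[r]≈0) (zeroˡ _))) (+-identityˡ _))

  VanishesToOrder : List (K × ℕ) → K → ℕ → Set ℓ
  VanishesToOrder H r m = ∀ l → l < m → ⟪ H ∣ hasse r l ⟫ ≈ 0#

  HasseFunctional : Multiset → Seq → Set c
  HasseFunctional T ψ = ∃₂ λ v l → l < mult T v × ψ ≡ hasse (elem T v) l

  ÷-vanishes-at-root : ∀ {r m} H → VanishesToOrder H r (suc m) → VanishesToOrder (H ÷ r) r m
  ÷-vanishes-at-root {r} H H≈0 l l<m = begin
    ⟪ H ÷ r ∣ hasse r l ⟫                      ≈⟨ ⟪⟫-cong (H ÷ r) X+-hasse ⟨
    ⟪ H ÷ r ∣ X+ (- r) (hasse r (suc l)) ⟫     ≈⟨ ÷-adjoint H (H≈0 0 (s≤s z≤n)) (hasse r (suc l)) ⟨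
    ⟪ H ∣ hasse r (suc l) ⟫                    ≈⟨ H≈0 (suc l) (s≤s l<m) ⟩
    0#                                         ∎
    where
    X+-hasse : X+ (- r) (hasse r (suc l)) ≐ hasse r l
    X+-hasse e = trans (X+-hasse-suc r r l e)
                   (trans (+-congʳ (trans (*-congʳ (-‿inverseʳ r)) (zeroˡ _))) (+-identityˡ _))

  ÷-vanishes-elsewhere : ∀ {r w m} H → ¬ (w ≈ r) → ⟪ H ∣ hasse r zero ⟫ ≈ 0# →
                         VanishesToOrder H w m → VanishesToOrder (H ÷ r) w m
  ÷-vanishes-elsewhere {r} {w} {m} H w≉r H[r]≈0 H≈0 = go
    where
    w-r≉0 : ¬ (w - r ≈ 0#)
    w-r≉0 w-r≈0 = w≉r (x∙y⁻¹≈ε⇒x≈y w r w-r≈0)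

    go : VanishesToOrder (H ÷ r) w m
    go zero l<m = x*y≈0⇒y≈0 w-r≉0 (begin
      (w - r) * ⟪ H ÷ r ∣ hasse w zero ⟫           ≈⟨ ⟪⟫-*ˡ (H ÷ r) (w - r) (hasse w zero) ⟨
      ⟪ H ÷ r ∣ (λ e → (w - r) * hasse w zero e) ⟫ ≈⟨ ⟪⟫-cong (H ÷ r) (X+-hasse-zero r w) ⟨
      ⟪ H ÷ r ∣ X+ (- r) (hasse w zero) ⟫          ≈⟨ ÷-adjoint H H[r]≈0 (hasse w zero) ⟨
      ⟪ H ∣ hasse w zero ⟫                         ≈⟨ H≈0 zero l<m ⟩
      0#                                           ∎)
    go (suc l) l<m = x*y≈0⇒y≈0 w-r≉0 (begin
      (w - r) * ⟪ H ÷ r ∣ hasse w (suc l) ⟫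
        ≈⟨ +-identityʳ _ ⟨
      (w - r) * ⟪ H ÷ r ∣ hasse w (suc l) ⟫ + 0#
        ≈⟨ +-cong (⟪⟫-*ˡ (H ÷ r) (w - r) (hasse w (suc l))) (go l (ℕP.<-trans (ℕP.n<1+n l) l<m)) ⟨
      ⟪ H ÷ r ∣ (λ e → (w - r) * hasse w (suc l) e) ⟫ + ⟪ H ÷ r ∣ hasse w l ⟫
        ≈⟨ ⟪⟫-+ (H ÷ r) _ (hasse w l) ⟨
      ⟪ H ÷ r ∣ (λ e → (w - r) * hasse w (suc l) e + hasse w l e) ⟫
        ≈⟨ ⟪⟫-cong (H ÷ r) (X+-hasse-suc r w l) ⟨
      ⟪ H ÷ r ∣ X+ (- r) (hasse w (suc l)) ⟫
        ≈⟨ ÷-adjoint H H[r]≈0 (hasse w (suc l)) ⟨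
      ⟪ H ∣ hasse w (suc l) ⟫
        ≈⟨ H≈0 (suc l) l<m ⟩
      0# ∎)

  -- A term list vanishing to order mult T i at every node i of I is divisible by
  -- nodePolyOver T I, so it pairs to zero with every sequence that polynomial annihilates.
  ⟪⟫-annihilated : ∀ T I H {ψ} → Unique I →
                   All (λ i → VanishesToOrder H (elem T i) (mult T i)) I →
                   (∀ e → nodeOp T I ψ e ≈ 0#) → ⟪ H ∣ ψ ⟫ ≈ 0#
  ⟪⟫-annihilated T []      H [] [] ψ≈0 = ⟪⟫≈0 H (All.universal (ψ≈0 ∘ proj₂) H)
  ⟪⟫-annihilated T (i ∷ I) H (i∉I ∷ unique) (Hᵢ ∷ H_I) op≈0 = peel (mult T i) H Hᵢ H_I op≈0
    where
    r : K
    r = elem T i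

    others≉r : All (λ j → ¬ (elem T j ≈ r)) I
    others≉r = All.map (λ i≢j eq → i≢j (P.sym (distinct T _ _ eq))) i∉I

    peel : ∀ m H {ψ} → VanishesToOrder H r m → All (λ j → VanishesToOrder H (elem T j) (mult T j)) I →
           (∀ e → X+^ (- r) m (nodeOp T I ψ) e ≈ 0#) → ⟪ H ∣ ψ ⟫ ≈ 0#
    peel zero    H _ H_I op≈0 = ⟪⟫-annihilated T I H unique H_I op≈0
    peel (suc m) H {ψ} Hᵣ H_I op≈0 = begin
      ⟪ H ∣ ψ ⟫               ≈⟨ ÷-adjoint H H[r]≈0 ψ ⟩
      ⟪ H ÷ r ∣ X+ (- r) ψ ⟫  ≈⟨ peel m (H ÷ r) (÷-vanishes-at-root H Hᵣ) Q_I op′≈0 ⟩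
      0#                      ∎
      where
      H[r]≈0 : ⟪ H ∣ hasse r zero ⟫ ≈ 0#
      H[r]≈0 = Hᵣ zero (s≤s z≤n)

      Q_I : All (λ j → VanishesToOrder (H ÷ r) (elem T j) (mult T j)) I
      Q_I = All.zipWith (λ (w≉r , Hw) → ÷-vanishes-elsewhere H w≉r H[r]≈0 Hw) (others≉r , H_I)

      op′≈0 : ∀ e → X+^ (- r) m (nodeOp T I (X+ (- r) ψ)) e ≈ 0#
      op′≈0 e = trans (X+^-cong (- r) m (nodeOp-X+-comm T I (- r) ψ) e)
                      (trans (X+^-X+-comm (- r) m (- r) (nodeOp T I ψ) e) (op≈0 e))

  -- Exponent bounds and monic operators

  ExponentsBelow : ℕ → Poly 1 → Set c
  ExponentsBelow L = All (λ t → Vec.head (proj₂ t) ≤ L)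

  ⟪⟫-dense : ∀ L (p : Poly 1) → ExponentsBelow L p →
             ∀ w → ⟪ p ∣ w ⟫ ≈ ∑[ k < suc L ] (coeff₁ p (toℕ k) * w (toℕ k ∷ []))
  ⟪⟫-dense L []                 []          w =
    sym (∑≈0 {suc L} (λ k → 0# * w (toℕ k ∷ [])) (λ k → zeroˡ _))
  ⟪⟫-dense L ((a , b ∷ []) ∷ p) (b≤L ∷ p≤L) w = sym (begin
    ∑[ k < suc L ] (coeff₁ ((a , b ∷ []) ∷ p) (toℕ k) * w (toℕ k ∷ []))
      ≈⟨ ∑-cong _ (λ k → first k + rest k) (λ k → trans (*-congʳ (coeff-∷ a (b ∷ []) p (toℕ k ∷ [])))
                                                         (distribʳ (w (toℕ k ∷ [])) _ _)) ⟩
    ∑[ k < suc L ] (first k + rest k)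
      ≈⟨ ∑-distrib-+ first rest ⟩
    ∑[ k < suc L ] first k + ∑[ k < suc L ] rest k
      ≈⟨ +-cong (trans (∑-single first b′ first-off-b) first-at-b) (sym (⟪⟫-dense L p p≤L w)) ⟩
    a * w (b ∷ []) + ⟪ p ∣ w ⟫ ∎)
    where
    first rest : Fin (suc L) → K
    first k = δ (≡-dec ℕ._≟_) (toℕ k ∷ []) (b ∷ []) * a * w (toℕ k ∷ [])
    rest  k = coeff₁ p (toℕ k) * w (toℕ k ∷ [])

    b′ : Fin (suc L)
    b′ = fromℕ< (s≤s b≤L)

    first-at-b : δ (≡-dec ℕ._≟_) (toℕ b′ ∷ []) (b ∷ []) * a * w (toℕ b′ ∷ []) ≈ a * w (b ∷ [])
    first-at-b rewrite FinP.toℕ-fromℕ< (s≤s b≤L) =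
      *-congʳ (trans (*-congʳ (δ-≡ (≡-dec ℕ._≟_) (b ∷ []) (b ∷ []) P.refl)) (*-identityˡ a))

    first-off-b : ∀ k → k ≢ b′ → first k ≈ 0#
    first-off-b k k≢b′ =
      trans (*-congʳ (trans (*-congʳ (δ-≢ (≡-dec ℕ._≟_) (toℕ k ∷ []) (b ∷ []) k≢b)) (zeroˡ a))) (zeroˡ _)
      where
      k≢b : toℕ k ∷ [] ≢ b ∷ []
      k≢b eq = k≢b′ (FinP.toℕ-injective (P.trans (P.cong Vec.head eq) (P.sym (FinP.toℕ-fromℕ< (s≤s b≤L)))))

  *P-exponents : ∀ {n} {P Q R : Vec ℕ n → Set} (p q : Poly n) →
                 All (P ∘ proj₂) p → All (Q ∘ proj₂) q → (∀ {α β} → P α → Q β → R (α ⊹ β)) →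
                 All (R ∘ proj₂) (p *P q)
  *P-exponents []            q []        Qq PQ⇒R = []
  *P-exponents ((a , α) ∷ p) q (Pα ∷ Pp) Qq PQ⇒R =
    ++⁺ (map⁺ (All.map (PQ⇒R Pα) Qq)) (*P-exponents p q Pp Qq PQ⇒R)

  *P-exponentsBelow : ∀ {L M} p q → ExponentsBelow L p → ExponentsBelow M q →
                      ExponentsBelow (L ℕ.+ M) (p *P q)
  *P-exponentsBelow {L} {M} p q p≤L q≤M =
    *P-exponents {P = λ β → Vec.head β ≤ L} {Q = λ β → Vec.head β ≤ M} {R = λ β → Vec.head β ≤ L ℕ.+ M}
                 p q p≤L q≤M (λ {α} {β} → head-+-mono-≤ {α} {β})
    where
    head-+-mono-≤ : ∀ {α β : Vec ℕ 1} → Vec.head α ≤ L → Vec.head β ≤ M → Vec.head (α ⊹ β) ≤ L ℕ.+ M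
    head-+-mono-≤ {a ∷ []} {b ∷ []} = ℕP.+-mono-≤

  ^P-exponents : ∀ c m → ExponentsBelow m ((linear Fin.zero c) ^P m)
  ^P-exponents c zero    = z≤n ∷ []
  ^P-exponents c (suc m) =
    *P-exponentsBelow (linear Fin.zero c) _ (s≤s z≤n ∷ z≤n ∷ []) (^P-exponents c m)

  degree : (T : Multiset) → List (Fin (size T)) → ℕ
  degree T = foldr (λ i acc → mult T i ℕ.+ acc) 0

  nodePolyOver-exponents : ∀ T I → ExponentsBelow (degree T I) (nodePolyOver T I)
  nodePolyOver-exponents T []      = z≤n ∷ []
  nodePolyOver-exponents T (i ∷ I) =
    *P-exponentsBelow _ (nodePolyOver T I) (^P-exponents (- elem T i) (mult T i))
                      (nodePolyOver-exponents T I)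

  coeff₁-above : ∀ {L} p → ExponentsBelow L p → ∀ {k} → L < k → coeff₁ p k ≈ 0#
  coeff₁-above {L} p p≤L {k} L<k =
    trans (coeff≈⟪δ⟫ p (k ∷ [])) (⟪⟫≈0 p (All.map (λ {t} → k≢exponent {t}) p≤L))
    where
    k≢exponent : ∀ {t : K × Vec ℕ 1} → Vec.head (proj₂ t) ≤ L → δ (≡-dec ℕ._≟_) (k ∷ []) (proj₂ t) ≈ 0#
    k≢exponent {t} b≤L = δ-≢ (≡-dec ℕ._≟_) (k ∷ []) (proj₂ t)
      λ eq → ℕP.<⇒≱ L<k (P.subst (_≤ L) (P.sym (P.cong Vec.head eq)) b≤L)

  coeff₁≈▸δ : ∀ p k → coeff₁ p k ≈ (p ▸ δ ℕ._≟_ k) 0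
  coeff₁≈▸δ p k = trans (coeff≈⟪δ⟫ p (k ∷ [])) (⟪⟫-cong p (λ { (b ∷ []) → δ-singleton b }))
    where
    δ-singleton : ∀ b → δ (≡-dec ℕ._≟_) (k ∷ []) (b ∷ []) ≈ δ ℕ._≟_ k (b ℕ.+ 0)
    δ-singleton b = by-cases (k ℕ.≟ b)
      where
      by-cases : Dec (k ≡ b) → δ (≡-dec ℕ._≟_) (k ∷ []) (b ∷ []) ≈ δ ℕ._≟_ k (b ℕ.+ 0)
      by-cases (yes k≡b) = trans (δ-≡ (≡-dec ℕ._≟_) (k ∷ []) (b ∷ []) (P.cong (_∷ []) k≡b))
                                 (sym (δ-≡ ℕ._≟_ k (b ℕ.+ 0) (P.trans k≡b (P.sym (ℕP.+-identityʳ b)))))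
      by-cases (no  k≢b) = trans (δ-≢ (≡-dec ℕ._≟_) (k ∷ []) (b ∷ []) (k≢b ∘ P.cong Vec.head))
                                 (sym (δ-≢ ℕ._≟_ k (b ℕ.+ 0) (λ eq → k≢b (P.trans eq (ℕP.+-identityʳ b)))))

  -- O acts like (p ▸_) for a monic p of degree L: on ψ vanishing below L + d,
  -- only the leading term survives.
  MonicOfDegree : ℕ → (Seq → Seq) → Set (c Level.⊔ ℓ)
  MonicOfDegree L O = ∀ ψ d → (∀ e → e < L ℕ.+ d → ψ e ≈ 0#) → O ψ d ≈ ψ (L ℕ.+ d)

  X+-monic : ∀ c → MonicOfDegree 1 (X+ c)
  X+-monic c ψ d ψ≈0 = trans (+-congˡ (trans (*-congˡ (ψ≈0 d (ℕP.n<1+n d))) (zeroʳ c))) (+-identityʳ _)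

  ∘-monic : ∀ {L₁ L₂ O₁ O₂} → MonicOfDegree L₁ O₁ → MonicOfDegree L₂ O₂ →
            MonicOfDegree (L₁ ℕ.+ L₂) (O₁ ∘ O₂)
  ∘-monic {L₁} {L₂} {O₁} {O₂} O₁-monic O₂-monic ψ d ψ≈0 = begin
    O₁ (O₂ ψ) d             ≈⟨ O₁-monic (O₂ ψ) d O₂ψ≈0 ⟩
    O₂ ψ (L₁ ℕ.+ d)         ≈⟨ O₂-monic ψ (L₁ ℕ.+ d) (λ e e< → ψ≈0 e (P.subst (e <_) reassoc e<)) ⟩
    ψ (L₂ ℕ.+ (L₁ ℕ.+ d))   ≡⟨ P.cong ψ reassoc ⟩
    ψ (L₁ ℕ.+ L₂ ℕ.+ d)     ∎
    where
    reassoc : L₂ ℕ.+ (L₁ ℕ.+ d) ≡ L₁ ℕ.+ L₂ ℕ.+ d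
    reassoc = P.trans (P.sym (ℕP.+-assoc L₂ L₁ d)) (P.cong (ℕ._+ d) (ℕP.+-comm L₂ L₁))

    O₂ψ≈0 : ∀ e → e < L₁ ℕ.+ d → O₂ ψ e ≈ 0#
    O₂ψ≈0 e e< = trans (O₂-monic ψ e (λ e′ e′< → ψ≈0 e′ (ℕP.<-trans e′< L₂+e<))) (ψ≈0 (L₂ ℕ.+ e) L₂+e<)
      where
      L₂+e< : L₂ ℕ.+ e < L₁ ℕ.+ L₂ ℕ.+ d
      L₂+e< = P.subst (L₂ ℕ.+ e <_) reassoc (ℕP.+-monoʳ-< L₂ e<)

  X+^-monic : ∀ c m → MonicOfDegree m (X+^ c m)
  X+^-monic c zero    ψ d ψ≈0 = refl
  X+^-monic c (suc m) = ∘-monic (X+-monic c) (X+^-monic c m)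

  nodeOp-monic : ∀ T I → MonicOfDegree (degree T I) (nodeOp T I)
  nodeOp-monic T []      ψ d ψ≈0 = refl
  nodeOp-monic T (i ∷ I) = ∘-monic (X+^-monic (- elem T i) (mult T i)) (nodeOp-monic T I)

  -- The dual sequence of a λ-null multiset

  module Recurrence (ν : ℕ) (κ : ℕ → K) (initial : Seq) where

    private
      earlier : ∀ {e} → ¬ e < ν → (k : Fin ν) → toℕ k ℕ.+ (e ℕ.∸ ν) < e
      earlier {e} e≮ν k = P.subst (toℕ k ℕ.+ (e ℕ.∸ ν) <_) (ℕP.m+[n∸m]≡n (ℕP.≮⇒≥ e≮ν))
                                  (ℕP.+-monoˡ-< (e ℕ.∸ ν) (FinP.toℕ<n k))

      step : ∀ e → (∀ {e′} → e′ < e → K) → K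
      step e rec with e ℕ.<? ν
      ... | yes _   = initial e
      ... | no  e≮ν = - ∑[ k < ν ] (κ (toℕ k) * rec (earlier e≮ν k))

      step-ext : ∀ e {rec rec′ : ∀ {e′} → e′ < e → K} →
                 (∀ {e′} (e′<e : e′ < e) → rec e′<e ≡ rec′ e′<e) → step e rec ≡ step e rec′
      step-ext e rec≡rec′ with e ℕ.<? ν
      ... | yes _   = P.refl
      ... | no  e≮ν = P.cong -_ (sum-cong-≗ (λ k → P.cong (κ (toℕ k) *_) (rec≡rec′ (earlier e≮ν k))))

      open WF.FixPoint ℕI.<-wellFounded (λ _ → K) step step-ext using (unfold-wfRec)

    sequence : Seq
    sequence = WF.All.wfRec ℕI.<-wellFounded c (λ _ → K) step

    sequence-initial : ∀ e → e < ν → sequence e ≈ initial e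
    sequence-initial e e<ν = trans (reflexive unfold-wfRec) step-initial
      where
      step-initial : step e (λ {e′} _ → sequence e′) ≈ initial e
      step-initial with e ℕ.<? ν
      ... | yes _   = refl
      ... | no  e≮ν = contradiction e<ν e≮ν

    sequence-recurrence : ∀ d →
      ∑[ k < ν ] (κ (toℕ k) * sequence (toℕ k ℕ.+ d)) + sequence (ν ℕ.+ d) ≈ 0#
    sequence-recurrence d = trans (+-congˡ (trans (reflexive unfold-wfRec) step-beyond)) (-‿inverseʳ _)
      where
      step-beyond : step (ν ℕ.+ d) (λ {e′} _ → sequence e′) ≈
                    - ∑[ k < ν ] (κ (toℕ k) * sequence (toℕ k ℕ.+ d))
      step-beyond with (ν ℕ.+ d) ℕ.<? ν
      ... | yes ν+d<ν = contradiction ν+d<ν (ℕP.≤⇒≯ (ℕP.m≤m+n ν d))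
      ... | no  _     = -‿cong (∑-cong {ν} (λ k → κ (toℕ k) * sequence (toℕ k ℕ.+ (ν ℕ.+ d ℕ.∸ ν)))
                                       (λ k → κ (toℕ k) * sequence (toℕ k ℕ.+ d)) λ k →
                          reflexive (P.cong (λ x → κ (toℕ k) * sequence (toℕ k ℕ.+ x)) (ℕP.m+n∸m≡n ν d)))

  -- The functional on K[x] that kills the ideal of nodePoly T and, on monomials of degree
  -- below ‖ T ‖, picks out the coefficient of x^a.
  module DualSequence (T : Multiset) (a λ′ : ℕ) (T-null : IsNull λ′ T) (a<‖T‖ : a < ‖ T ‖) where

    private
      ν : ℕ
      ν = ‖ T ‖

      N : Poly 1
      N = nodePoly T

      N-exponents : ExponentsBelow ν N
      N-exponents = nodePolyOver-exponents T (allFin (size T))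

      N-leading : coeff₁ N ν ≈ 1#
      N-leading = begin
        coeff₁ N ν                                ≈⟨ coeff₁≈▸δ N ν ⟩
        (N ▸ δ ℕ._≟_ ν) 0                         ≈⟨ ▸-nodePolyOver T (allFin (size T)) (δ ℕ._≟_ ν) 0 ⟩
        nodeOp T (allFin (size T)) (δ ℕ._≟_ ν) 0  ≈⟨ nodeOp-monic T (allFin (size T)) (δ ℕ._≟_ ν) 0 below-ν ⟩
        δ ℕ._≟_ ν (ν ℕ.+ 0)                       ≈⟨ δ-≡ ℕ._≟_ ν (ν ℕ.+ 0) (P.sym (ℕP.+-identityʳ ν)) ⟩
        1#                                        ∎
        where
        below-ν : ∀ e → e < ν ℕ.+ 0 → δ ℕ._≟_ ν e ≈ 0#
        below-ν e e<ν = δ-≢ ℕ._≟_ ν e λ ν≡e → ℕP.<⇒≢ e<ν (P.trans (P.sym ν≡e) (P.sym (ℕP.+-identityʳ ν)))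

      N-lacunary : ∀ k → ν ℕ.∸ λ′ ≤ k → k < ν → coeff₁ N k ≈ 0#
      N-lacunary = T-null ν ((λ N-leading≈0 → 0≉1 (trans (sym N-leading≈0) N-leading))
                           , (λ k ν<k → coeff₁-above N N-exponents ν<k))

      open Recurrence ν (coeff₁ N) (δ ℕ._≟_ a) using (sequence-initial; sequence-recurrence)

    φ : Seq
    φ = Recurrence.sequence ν (coeff₁ N) (δ ℕ._≟_ a)

    φ-annihilated : ∀ e → nodeOp T (allFin (size T)) φ e ≈ 0#
    φ-annihilated e = begin
      nodeOp T (allFin (size T)) φ e
        ≈⟨ ▸-nodePolyOver T (allFin (size T)) φ e ⟨
      (N ▸ φ) e
        ≈⟨ ⟪⟫-dense ν N N-exponents _ ⟩
      ∑[ k < suc ν ] (coeff₁ N (toℕ k) * φ (toℕ k ℕ.+ e))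
        ≈⟨ sum-init-last (λ k → coeff₁ N (toℕ k) * φ (toℕ k ℕ.+ e)) ⟩
      ∑[ k < ν ] (coeff₁ N (toℕ (Fin.inject₁ k)) * φ (toℕ (Fin.inject₁ k) ℕ.+ e))
        + coeff₁ N (toℕ (Fin.fromℕ ν)) * φ (toℕ (Fin.fromℕ ν) ℕ.+ e)
        ≈⟨ +-cong (∑-cong {ν} _ (λ k → coeff₁ N (toℕ k) * φ (toℕ k ℕ.+ e))
                          (λ k → reflexive (P.cong (λ j → coeff₁ N j * φ (j ℕ.+ e)) (FinP.toℕ-inject₁ k))))
                  (trans (reflexive (P.cong (λ j → coeff₁ N j * φ (j ℕ.+ e)) (FinP.toℕ-fromℕ ν)))
                         (trans (*-congʳ N-leading) (*-identityˡ _))) ⟩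
      ∑[ k < ν ] (coeff₁ N (toℕ k) * φ (toℕ k ℕ.+ e)) + φ (ν ℕ.+ e)
        ≈⟨ sequence-recurrence e ⟩
      0# ∎

    φ-dominated : ∀ H → (∀ ψ → HasseFunctional T ψ → ⟪ H ∣ ψ ⟫ ≈ 0#) → ⟪ H ∣ φ ⟫ ≈ 0#
    φ-dominated H H⊥hasse = ⟪⟫-annihilated T (allFin (size T)) H (allFin⁺ (size T))
      (All.universal (λ v l l<m → H⊥hasse (hasse (elem T v) l) (v , l , l<m , P.refl)) (allFin (size T)))
      φ-annihilated

    φ-at-a : φ a ≈ 1#
    φ-at-a = trans (sequence-initial a a<‖T‖) (δ-≡ ℕ._≟_ a a P.refl)

    φ-below : ∀ e → e < ν → e ≢ a → φ e ≈ 0#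
    φ-below e e<ν e≢a = trans (sequence-initial e e<ν) (δ-≢ ℕ._≟_ a e (e≢a ∘ P.sym))

    φ-lacunary : ∀ e → ν ≤ e → e ≤ a ℕ.+ λ′ → φ e ≈ 0#
    φ-lacunary e ν≤e e≤a+λ′ = begin
      φ e                                                ≡⟨ P.cong φ (ℕP.m+[n∸m]≡n ν≤e) ⟨
      φ (ν ℕ.+ d)                                        ≈⟨ +-inverseʳ-unique _ _ (sequence-recurrence d) ⟩
      - ∑[ k < ν ] (coeff₁ N (toℕ k) * φ (toℕ k ℕ.+ d))
        ≈⟨ -‿cong (∑≈0 {ν} _ λ k → term≈0 (toℕ k) (FinP.toℕ<n k)) ⟩
      - 0#                                               ≈⟨ -0#≈0# ⟩
      0#                                                 ∎
      where
      d : ℕ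
      d = e ℕ.∸ ν

      term≈0 : ∀ k → k < ν → coeff₁ N k * φ (k ℕ.+ d) ≈ 0#
      term≈0 k k<ν with k ℕ.+ d ℕ.<? a
      ... | yes k+d<a =
        trans (*-congˡ (φ-below (k ℕ.+ d) (ℕP.<-trans k+d<a a<‖T‖) (ℕP.<⇒≢ k+d<a))) (zeroʳ _)
      ... | no  k+d≮a = trans (*-congʳ (N-lacunary k ν∸λ′≤k k<ν)) (zeroˡ _)
        where
        ν+d≤k+λ′+d : ν ℕ.+ d ≤ k ℕ.+ λ′ ℕ.+ d
        ν+d≤k+λ′+d = P.subst₂ _≤_ (P.sym (ℕP.m+[n∸m]≡n ν≤e)) (swap-λ′-d k d λ′)
                       (ℕP.≤-trans e≤a+λ′ (ℕP.+-monoˡ-≤ λ′ (ℕP.≮⇒≥ k+d≮a)))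
          where
          swap-λ′-d : ∀ x y z → x ℕ.+ y ℕ.+ z ≡ x ℕ.+ z ℕ.+ y
          swap-λ′-d x y z = P.trans (ℕP.+-assoc x y z)
                              (P.trans (P.cong (x ℕ.+_) (ℕP.+-comm y z)) (P.sym (ℕP.+-assoc x z y)))
        ν∸λ′≤k : ν ℕ.∸ λ′ ≤ k
        ν∸λ′≤k = P.subst (ν ℕ.∸ λ′ ≤_) (ℕP.m+n∸n≡m k λ′)
                         (ℕP.∸-monoˡ-≤ λ′ (ℕP.+-cancelʳ-≤ d ν (k ℕ.+ λ′) ν+d≤k+λ′+d))

    φ-vanishes : ∀ e → (e < a) ⊎ ((a ℕ.+ 1 ≤ e × e < ν) ⊎ e ∈[ ν , a ℕ.+ λ′ ]) → φ e ≈ 0#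
    φ-vanishes e (inj₁ e<a)                     = φ-below e (ℕP.<-trans e<a a<‖T‖) (ℕP.<⇒≢ e<a)
    φ-vanishes e (inj₂ (inj₁ (a+1≤e , e<ν)))    =
      φ-below e e<ν (λ e≡a → ℕP.<-irrefl (P.sym e≡a) (P.subst (_≤ e) (ℕP.+-comm a 1) a+1≤e))
    φ-vanishes e (inj₂ (inj₂ (ν≤e , e≤a+λ′)))   = φ-lacunary e ν≤e e≤a+λ′

  -- Tensor weights and Hasse derivatives

  ⨂ : ∀ {n} → (Fin n → Seq) → Weight n
  ⨂ χ β = ∏ (λ i → χ i (lookup β i))

  ⨂-omit : ∀ {n} → Fin n → (Fin n → Seq) → Weight n
  ⨂-omit i χ = ⨂ (updateAt χ i (λ _ _ → 1#))

  ⨂-cong : ∀ {n} (χ χ′ : Fin n → Seq) β β′ → (∀ i → χ i (lookup β i) ≈ χ′ i (lookup β′ i)) →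
           ⨂ χ β ≈ ⨂ χ′ β′
  ⨂-cong {n} χ χ′ β β′ = Product.sum-cong-≋ {n} {λ i → χ i (lookup β i)} {λ i → χ′ i (lookup β′ i)}

  ⨂-≡ : ∀ {n} {χ χ′ : Fin n → Seq} → (∀ i → χ i ≡ χ′ i) → ⨂ χ ≐ ⨂ χ′
  ⨂-≡ {χ = χ} {χ′} χ≡χ′ β = ⨂-cong χ χ′ β β (λ i → reflexive (P.cong-app (χ≡χ′ i) (lookup β i)))

  ⨂-one : ∀ {n} (χ : Fin n → Seq) β → (∀ i → χ i (lookup β i) ≈ 1#) → ⨂ χ β ≈ 1#
  ⨂-one {n} χ β χ≈1 = trans (Product.sum-cong-≋ χ≈1) (Product.sum-replicate-zero n)

  ⨂-factor : ∀ {n} (χ : Fin n → Seq) i β → ⨂ χ β ≈ χ i (lookup β i) * ⨂-omit i χ β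
  ⨂-factor {suc n} χ i β = begin
    ⨂ χ β                                           ≈⟨ Product.sum-remove {i = i} (factors χ) ⟩
    χ i (lookup β i) * ∏ (removeAt (factors χ) i)   ≈⟨ *-congˡ (Product.sum-cong-≋ others-agree) ⟩
    χ i (lookup β i) * ∏ (removeAt (factors χ₁) i)  ≈⟨ *-congˡ omit-factor ⟨
    χ i (lookup β i) * ⨂-omit i χ β                 ∎
    where
    χ₁ : Fin (suc n) → Seq
    χ₁ = updateAt χ i (λ _ _ → 1#)

    factors : (Fin (suc n) → Seq) → Fin (suc n) → K
    factors ξ j = ξ j (lookup β j)

    others-agree : ∀ j → removeAt (factors χ) i j ≈ removeAt (factors χ₁) i j
    others-agree j = reflexive (P.cong-app (P.sym (VectorP.updateAt-minimal _ i χ (FinP.punchInᵢ≢i i j))) _)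

    omit-factor : ⨂-omit i χ β ≈ ∏ (removeAt (factors χ₁) i)
    omit-factor = trans (Product.sum-remove {i = i} (factors χ₁))
                        (trans (*-congʳ (reflexive (P.cong-app (VectorP.updateAt-updates i χ) _)))
                               (*-identityˡ _))

  ⨂-omit-cong : ∀ {n} i (χ χ′ : Fin n → Seq) β β′ →
                (∀ j → j ≢ i → χ j (lookup β j) ≈ χ′ j (lookup β′ j)) → ⨂-omit i χ β ≈ ⨂-omit i χ′ β′
  ⨂-omit-cong i χ χ′ β β′ agree = ⨂-cong (updateAt χ i (λ _ _ → 1#)) (updateAt χ′ i (λ _ _ → 1#)) β β′ factor
    where
    factor : ∀ j → updateAt χ i (λ _ _ → 1#) j (lookup β j) ≈ updateAt χ′ i (λ _ _ → 1#) j (lookup β′ j)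
    factor j with j Fin.≟ i
    ... | yes P.refl = reflexive (P.trans (P.cong-app (VectorP.updateAt-updates j χ) _)
                                          (P.sym (P.cong-app (VectorP.updateAt-updates j χ′) _)))
    ... | no  j≢i    = trans (reflexive (P.cong-app (VectorP.updateAt-minimal j i χ j≢i) _))
                             (trans (agree j j≢i)
                                    (sym (reflexive (P.cong-app (VectorP.updateAt-minimal j i χ′ j≢i) _))))

  ⨂-updateAt : ∀ {n} (χ : Fin n → Seq) i g β → ⨂ (updateAt χ i g) β ≈ g (χ i) (lookup β i) * ⨂-omit i χ β
  ⨂-updateAt χ i g β = begin
    ⨂ (updateAt χ i g) β
      ≈⟨ ⨂-factor (updateAt χ i g) i β ⟩
    updateAt χ i g i (lookup β i) * ⨂-omit i (updateAt χ i g) β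
      ≈⟨ *-cong g-factor (⨂-omit-cong i _ χ β β others) ⟩
    g (χ i) (lookup β i) * ⨂-omit i χ β ∎
    where
    g-factor : updateAt χ i g i (lookup β i) ≈ g (χ i) (lookup β i)
    g-factor = reflexive (P.cong-app (VectorP.updateAt-updates i χ) (lookup β i))

    others : ∀ j → j ≢ i → updateAt χ i g j (lookup β j) ≈ χ j (lookup β j)
    others j j≢i = reflexive (P.cong-app (VectorP.updateAt-minimal j i χ j≢i) (lookup β j))

  ⨂-zero : ∀ {n} (χ : Fin n → Seq) i β → χ i (lookup β i) ≈ 0# → ⨂ χ β ≈ 0#
  ⨂-zero χ i β χᵢ≈0 = trans (⨂-factor χ i β) (trans (*-congʳ χᵢ≈0) (zeroˡ _))

  ▹-linear-⨂ : ∀ {n} (i : Fin n) c χ → linear i c ▹ ⨂ χ ≐ ⨂ (updateAt χ i (X+ c))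
  ▹-linear-⨂ i c χ β = begin
    (linear i c ▹ ⨂ χ) β
      ≈⟨ ▹-linear i c (⨂ χ) β ⟩
    ⨂ χ (𝐞 i ⊹ β) + c * ⨂ χ β
      ≈⟨ +-cong (⨂-factor χ i (𝐞 i ⊹ β)) (*-congˡ (⨂-factor χ i β)) ⟩
    χ i (lookup (𝐞 i ⊹ β) i) * ⨂-omit i χ (𝐞 i ⊹ β) + c * (χ i (lookup β i) * ⨂-omit i χ β)
      ≈⟨ +-congʳ (*-cong (reflexive (P.cong (χ i) (lookup-𝐞⊹-same i β)))
                         (⨂-omit-cong i χ χ (𝐞 i ⊹ β) β others)) ⟩
    χ i (suc (lookup β i)) * ⨂-omit i χ β + c * (χ i (lookup β i) * ⨂-omit i χ β)
      ≈⟨ solve 4 (λ x c y R → x :* R :+ c :* (y :* R) := (x :+ c :* y) :* R) refl _ c _ _ ⟩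
    X+ c (χ i) (lookup β i) * ⨂-omit i χ β
      ≈⟨ ⨂-updateAt χ i (X+ c) β ⟨
    ⨂ (updateAt χ i (X+ c)) β ∎
    where
    others : ∀ j → j ≢ i → χ j (lookup (𝐞 i ⊹ β) j) ≈ χ j (lookup β j)
    others j j≢i = reflexive (P.cong (χ j) (lookup-𝐞⊹-other i j β j≢i))

  ▹-^P-⨂ : ∀ {n} (i : Fin n) c m χ → linear i c ^P m ▹ ⨂ χ ≐ ⨂ (updateAt χ i (X+^ c m))
  ▹-^P-⨂ i c zero    χ β =
    trans (▹-constP 1# (⨂ χ) β) (trans (*-identityˡ _) (⨂-≡ (λ j → P.sym (VectorP.updateAt-id i χ j)) β))
  ▹-^P-⨂ i c (suc m) χ β = begin
    (linear i c *P (linear i c ^P m) ▹ ⨂ χ) β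
      ≈⟨ ▹-*P (linear i c) (linear i c ^P m) (⨂ χ) β ⟩
    (linear i c ▹ linear i c ^P m ▹ ⨂ χ) β
      ≈⟨ ▹-cong (linear i c) (▹-^P-⨂ i c m χ) β ⟩
    (linear i c ▹ ⨂ (updateAt χ i (X+^ c m))) β
      ≈⟨ ▹-linear-⨂ i c (updateAt χ i (X+^ c m)) β ⟩
    ⨂ (updateAt (updateAt χ i (X+^ c m)) i (X+ c)) β
      ≈⟨ ⨂-≡ (VectorP.updateAt-updateAt i {X+ c} {X+^ c m} χ) β ⟩
    ⨂ (updateAt χ i (X+^ c (suc m))) β ∎

  updateAll : ∀ {n} → List (Fin n) → (Fin n → Seq → Seq) → (Fin n → Seq) → Fin n → Seq
  updateAll I O χ = foldr (λ i ξ → updateAt ξ i (O i)) χ I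

  updateAll-∉ : ∀ {n} I O (χ : Fin n → Seq) j → All (_≢ j) I → updateAll I O χ j ≡ χ j
  updateAll-∉ []      O χ j []          = P.refl
  updateAll-∉ (i ∷ I) O χ j (i≢j ∷ I≢j) =
    P.trans (VectorP.updateAt-minimal j i (updateAll I O χ) (i≢j ∘ P.sym)) (updateAll-∉ I O χ j I≢j)

  updateAll-∈ : ∀ {n} I O (χ : Fin n → Seq) j → Unique I → j ∈ I → updateAll I O χ j ≡ O j (χ j)
  updateAll-∈ (i ∷ I) O χ j (i∉I ∷ _) (here P.refl) =
    P.trans (VectorP.updateAt-updates i (updateAll I O χ))
            (P.cong (O i) (updateAll-∉ I O χ i (All.map (λ i≢k k≡i → i≢k (P.sym k≡i)) i∉I)))
  updateAll-∈ (i ∷ I) O χ j (i∉I ∷ unique) (there j∈I) =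
    P.trans (VectorP.updateAt-minimal j i (updateAll I O χ) (λ j≡i → All.lookup i∉I j∈I (P.sym j≡i)))
            (updateAll-∈ I O χ j unique j∈I)

  ▹-linearPowers-⨂ : ∀ {n} (c : Fin n → K) (e : Fin n → ℕ) I χ →
                     foldr (λ i acc → (linear i (c i) ^P e i) *P acc) (constP 1#) I ▹ ⨂ χ
                       ≐ ⨂ (updateAll I (λ i → X+^ (c i) (e i)) χ)
  ▹-linearPowers-⨂ c e []      χ β = trans (▹-constP 1# (⨂ χ) β) (*-identityˡ _)
  ▹-linearPowers-⨂ {n} c e (i ∷ I) χ β = begin
    (Fᵢ *P Π ▹ ⨂ χ) β                                   ≈⟨ ▹-*P Fᵢ Π (⨂ χ) β ⟩
    (Fᵢ ▹ Π ▹ ⨂ χ) β                                    ≈⟨ ▹-cong Fᵢ (▹-linearPowers-⨂ c e I χ) β ⟩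
    (Fᵢ ▹ ⨂ (updateAll I (λ i → X+^ (c i) (e i)) χ)) β   ≈⟨ ▹-^P-⨂ i (c i) (e i) _ β ⟩
    ⨂ (updateAll (i ∷ I) (λ i → X+^ (c i) (e i)) χ) β   ∎
    where
    Fᵢ Π : Poly n
    Fᵢ = linear i (c i) ^P e i
    Π  = foldr (λ i acc → (linear i (c i) ^P e i) *P acc) (constP 1#) I

  δ⃗≈⨂δ : ∀ {n} (γ β : Vec ℕ n) → δ (≡-dec ℕ._≟_) γ β ≈ ⨂ (λ i → δ ℕ._≟_ (lookup γ i)) β
  δ⃗≈⨂δ []      []      = δ-≡ (≡-dec ℕ._≟_) [] [] P.refl
  δ⃗≈⨂δ (g ∷ γ) (b ∷ β) = trans (by-cases (g ℕ.≟ b) (≡-dec ℕ._≟_ γ β)) (*-congˡ (δ⃗≈⨂δ γ β))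
    where
    by-cases : Dec (g ≡ b) → Dec (γ ≡ β) →
               δ (≡-dec ℕ._≟_) (g ∷ γ) (b ∷ β) ≈ δ ℕ._≟_ g b * δ (≡-dec ℕ._≟_) γ β
    by-cases (yes g≡b) (yes γ≡β) =
      trans (δ-≡ (≡-dec ℕ._≟_) (g ∷ γ) (b ∷ β) (P.cong₂ _∷_ g≡b γ≡β))
            (sym (trans (*-cong (δ-≡ ℕ._≟_ g b g≡b) (δ-≡ (≡-dec ℕ._≟_) γ β γ≡β)) (*-identityˡ 1#)))
    by-cases _         (no γ≢β) =
      trans (δ-≢ (≡-dec ℕ._≟_) (g ∷ γ) (b ∷ β) (γ≢β ∘ P.cong Vec.tail))
            (sym (trans (*-congˡ (δ-≢ (≡-dec ℕ._≟_) γ β γ≢β)) (zeroʳ _)))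
    by-cases (no g≢b)  _        =
      trans (δ-≢ (≡-dec ℕ._≟_) (g ∷ γ) (b ∷ β) (g≢b ∘ P.cong Vec.head))
            (sym (trans (*-congʳ (δ-≢ ℕ._≟_ g b g≢b)) (zeroˡ _)))

  coeff-shift : ∀ {n} (f : Poly n) c γ → coeff (shift f c) γ ≈ ⟪ f ∣ ⨂ (λ i → hasse (c i) (lookup γ i)) ⟫
  coeff-shift {n} f c γ =
    trans (coeff≈⟪δ⟫ (shift f c) γ) (trans (⟪⟫-cong (shift f c) (δ⃗≈⨂δ γ)) (expand f))
    where
    Δ : Weight n
    Δ = ⨂ (λ i → δ ℕ._≟_ (lookup γ i))

    linearPowers : Vec ℕ n → Poly n
    linearPowers β = prodP (λ i → linear i (c i) ^P lookup β i)

    hasses : Fin n → Seq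
    hasses i = hasse (c i) (lookup γ i)

    updated : Vec ℕ n → Fin n → Seq
    updated β = updateAll (allFin n) (λ i → X+^ (c i) (lookup β i)) (λ i → δ ℕ._≟_ (lookup γ i))

    hasse-factor : ∀ β i → updated β i (lookup 0⃗ i) ≈ hasse (c i) (lookup γ i) (lookup β i)
    hasse-factor β i = trans (reflexive (P.cong₂ _$_ (updateAll-∈ (allFin n) _ _ i (allFin⁺ n) (∈-allFin i))
                                                    (VecP.lookup-replicate i 0)))
                             (X+^-δ (c i) (lookup β i) 0 (lookup γ i))

    term : ∀ a β → ⟪ constP a *P linearPowers β ∣ Δ ⟫ ≈ a * ⨂ hasses β
    term a β = begin
      ⟪ constP a *P linearPowers β ∣ Δ ⟫            ≈⟨ ⟪⟫-*P (constP a) (linearPowers β) Δ ⟩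
      a * ⟪ linearPowers β ∣ (λ α → Δ (0⃗ ⊹ α)) ⟫ + 0#
        ≈⟨ trans (+-identityʳ _) (*-congˡ (⟪⟫-cong (linearPowers β) λ α →
                   reflexive (P.cong Δ (P.trans (⊹-identityˡ α) (P.sym (⊹-identityʳ α)))))) ⟩
      a * (linearPowers β ▹ Δ) 0⃗
        ≈⟨ *-congˡ (▹-linearPowers-⨂ c (lookup β) (allFin n) _ 0⃗) ⟩
      a * ⨂ (updated β) 0⃗
        ≈⟨ *-congˡ (⨂-cong (updated β) hasses 0⃗ β (hasse-factor β)) ⟩
      a * ⨂ hasses β     ∎

    expand : ∀ f → ⟪ shift f c ∣ Δ ⟫ ≈ ⟪ f ∣ ⨂ hasses ⟫
    expand []            = refl
    expand ((a , β) ∷ f) =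
      trans (⟪⟫-++ (constP a *P linearPowers β) (shift f c) Δ) (+-cong (term a β) (expand f))

  varP^-exponents : ∀ {n} (i : Fin n) m → All (λ t → m ≤ lookup (proj₂ t) i) (varP i ^P m)
  varP^-exponents i zero    = z≤n ∷ []
  varP^-exponents i (suc m) =
    *P-exponents {P = λ α → 1 ≤ lookup α i} {Q = λ α → m ≤ lookup α i} {R = λ α → suc m ≤ lookup α i}
                 (varP i) (varP i ^P m) (ℕP.≤-reflexive (P.sym (lookup-𝐞-same i)) ∷ []) (varP^-exponents i m)
                 (λ {α} {β} 1≤αᵢ m≤βᵢ → P.subst (suc m ≤_) (P.sym (lookup-⊹ α β i)) (ℕP.+-mono-≤ 1≤αᵢ m≤βᵢ))

  -- Every monomial of Σᵢ xᵢ^{mᵢ} gᵢ has some exponent γᵢ ≥ mᵢ.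
  coeff-ideal≈0 : ∀ {n} (m : Fin n → ℕ) (g : Fin n → Poly n) γ → (∀ i → lookup γ i < m i) →
                  coeff (sumP (λ i → (varP i ^P m i) *P g i)) γ ≈ 0#
  coeff-ideal≈0 {n} m g γ γ<m =
    trans (coeff≈⟪δ⟫ ideal γ) (⟪⟫≈0 ideal (All.map (λ {t} → γ≢exponent {t}) (exponents (allFin n))))
    where
    ideal : Poly n
    ideal = sumP (λ i → (varP i ^P m i) *P g i)

    Large : Vec ℕ n → Set
    Large α = ∃ λ i → m i ≤ lookup α i

    large : ∀ i {α β} → m i ≤ lookup α i → ⊤ → Large (α ⊹ β)
    large i {α} {β} mᵢ≤αᵢ _ = i , P.subst (m i ≤_) (P.sym (lookup-⊹ α β i)) (ℕP.≤-trans mᵢ≤αᵢ (ℕP.m≤m+n _ _))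

    exponents : ∀ I → All (Large ∘ proj₂) (foldr (λ i acc → ((varP i ^P m i) *P g i) +P acc) [] I)
    exponents []      = []
    exponents (i ∷ I) =
      ++⁺ (*P-exponents {P = λ α → m i ≤ lookup α i} {Q = λ _ → ⊤} {R = Large} (varP i ^P m i) (g i)
                        (varP^-exponents i (m i)) (All.universal (λ _ → tt) (g i))
                        (λ {α} {β} → large i {α} {β}))
          (exponents I)

    γ≢exponent : ∀ {t : K × Vec ℕ n} → Large (proj₂ t) → δ (≡-dec ℕ._≟_) γ (proj₂ t) ≈ 0#
    γ≢exponent {t} (i , mᵢ≤) = δ-≢ (≡-dec ℕ._≟_) γ (proj₂ t)
      λ γ≡ → ℕP.<⇒≱ (γ<m i) (P.subst (λ α → m i ≤ lookup α i) (P.sym γ≡) mᵢ≤)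

  vanishes⇒⟪⟫-hasse≈0 : ∀ {n} (S : Fin n → Multiset) f → VanishesOn f S →
                        ∀ χ → (∀ i → HasseFunctional (S i) (χ i)) → ⟪ f ∣ ⨂ χ ⟫ ≈ 0#
  vanishes⇒⟪⟫-hasse≈0 {n} S f f-vanishes χ χ-hasse = begin
    ⟪ f ∣ ⨂ χ ⟫                          ≈⟨ ⟪⟫-cong f (⨂-≡ χ≡) ⟩
    ⟪ f ∣ ⨂ (λ i → hasse (u i) (lookup γ i)) ⟫ ≈⟨ coeff-shift f u γ ⟨
    coeff (shift f u) γ                  ≈⟨ proj₂ (f-vanishes v) γ ⟩
    coeff (sumP (λ i → (varP i ^P mult (S i) (v i)) *P proj₁ (f-vanishes v) i)) γ
                                         ≈⟨ coeff-ideal≈0 _ (proj₁ (f-vanishes v)) γ γ<m ⟩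
    0#                                   ∎
    where
    v : (i : Fin n) → Fin (size (S i))
    v i = proj₁ (χ-hasse i)

    u : Fin n → K
    u i = elem (S i) (v i)

    γ : Vec ℕ n
    γ = tabulate (λ i → proj₁ (proj₂ (χ-hasse i)))

    γ<m : ∀ i → lookup γ i < mult (S i) (v i)
    γ<m i = P.subst (_< mult (S i) (v i)) (P.sym (VecP.lookup∘tabulate _ i))
                    (proj₁ (proj₂ (proj₂ (χ-hasse i))))

    χ≡ : ∀ i → χ i ≡ hasse (u i) (lookup γ i)
    χ≡ i = P.trans (proj₂ (proj₂ (proj₂ (χ-hasse i))))
                   (P.cong (hasse (u i)) (P.sym (VecP.lookup∘tabulate _ i)))

  contract : ∀ {n} → Poly n → Fin n → (Fin n → Seq) → List (K × ℕ)
  contract f i χ = map (λ t → (⨂-omit i χ (proj₂ t) * proj₁ t , lookup (proj₂ t) i)) f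

  ⟪⟫-contract : ∀ {n} (f : Poly n) i χ ψ → ⟪ f ∣ ⨂ (updateAt χ i (const ψ)) ⟫ ≈ ⟪ contract f i χ ∣ ψ ⟫
  ⟪⟫-contract f i χ ψ = trans (⟪⟫-cong f (λ β → trans (⨂-updateAt χ i (const ψ) β) (*-comm _ _)))
                              (sym (⟪⟫-map f (⨂-omit i χ) (λ β → lookup β i) ψ))

  ⟪⟫-⨂-replace : ∀ {n a} (f : Poly n) (Admissible : Fin n → Seq → Set a) (φ : Fin n → Seq) →
                 (∀ i H → (∀ ψ → Admissible i ψ → ⟪ H ∣ ψ ⟫ ≈ 0#) → ⟪ H ∣ φ i ⟫ ≈ 0#) →
                 (∀ χ → (∀ i → Admissible i (χ i)) → ⟪ f ∣ ⨂ χ ⟫ ≈ 0#) →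
                 ⟪ f ∣ ⨂ φ ⟫ ≈ 0#
  ⟪⟫-⨂-replace {n} {a} f Admissible φ φ-dominated f⊥admissible =
    replaced n ℕP.≤-refl φ (λ _ _ → P.refl) (λ i n≤i → contradiction (FinP.toℕ<n i) (ℕP.≤⇒≯ n≤i))
    where
    Replaced : ℕ → Set (c Level.⊔ a Level.⊔ ℓ)
    Replaced m = ∀ χ → (∀ i → toℕ i < m → χ i ≡ φ i) → (∀ i → m ≤ toℕ i → Admissible i (χ i)) →
                 ⟪ f ∣ ⨂ χ ⟫ ≈ 0#

    replaced : ∀ m → m ≤ n → Replaced m
    replaced zero    _   χ _   admissible = f⊥admissible χ (λ i → admissible i z≤n)
    replaced (suc m) m<n χ χ≡φ admissible = begin
      ⟪ f ∣ ⨂ χ ⟫                             ≈⟨ ⟪⟫-cong f (⨂-≡ χ≡φᵢ) ⟩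
      ⟪ f ∣ ⨂ (updateAt χ i (const (φ i))) ⟫  ≈⟨ ⟪⟫-contract f i χ (φ i) ⟩
      ⟪ contract f i χ ∣ φ i ⟫                ≈⟨ φ-dominated i (contract f i χ) contract⊥admissible ⟩
      0#                                      ∎
      where
      i : Fin n
      i = fromℕ< m<n

      toℕ-i : toℕ i ≡ m
      toℕ-i = FinP.toℕ-fromℕ< m<n

      χ≡φᵢ : ∀ j → χ j ≡ updateAt χ i (const (φ i)) j
      χ≡φᵢ j with j Fin.≟ i
      ... | yes P.refl = P.trans (χ≡φ j (s≤s (ℕP.≤-reflexive toℕ-i))) (P.sym (VectorP.updateAt-updates j χ))
      ... | no  j≢i    = P.sym (VectorP.updateAt-minimal j i χ j≢i)

      contract⊥admissible : ∀ ψ → Admissible i ψ → ⟪ contract f i χ ∣ ψ ⟫ ≈ 0#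
      contract⊥admissible ψ ψ-admissible =
        trans (sym (⟪⟫-contract f i χ ψ)) (replaced m (ℕP.<⇒≤ m<n) (updateAt χ i (const ψ)) below above)
        where
        below : ∀ j → toℕ j < m → updateAt χ i (const ψ) j ≡ φ j
        below j j<m = P.trans (VectorP.updateAt-minimal j i χ j≢i) (χ≡φ j (ℕP.m<n⇒m<1+n j<m))
          where
          j≢i : j ≢ i
          j≢i j≡i = ℕP.<⇒≢ j<m (P.trans (P.cong toℕ j≡i) toℕ-i)

        above : ∀ j → m ≤ toℕ j → Admissible j (updateAt χ i (const ψ) j)
        above j m≤j with j Fin.≟ i
        ... | yes P.refl = P.subst (Admissible j) (P.sym (VectorP.updateAt-updates j χ)) ψ-admissible
        ... | no  j≢i    = P.subst (Admissible j) (P.sym (VectorP.updateAt-minimal j i χ j≢i))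
                                   (admissible j (ℕP.≤∧≢⇒< m≤j (j≢i ∘ m≡toℕj⇒j≡i)))
          where
          m≡toℕj⇒j≡i : m ≡ toℕ j → j ≡ i
          m≡toℕj⇒j≡i m≡j = FinP.toℕ-injective (P.trans (P.sym m≡j) (P.sym toℕ-i))

  -- Isolating one coefficient

  -- Decided by the same test as coeff, so that both reduce together in ⟪⟫-peel.
  infixl 8 _∖_
  _∖_ : ∀ {n} → Weight n → Vec ℕ n → Weight n
  (W ∖ β) γ with ≡-dec ℕ._≟_ β γ
  ... | yes _ = 0#
  ... | no  _ = W γ

  ∖-same : ∀ {n} (W : Weight n) β → (W ∖ β) β ≈ 0#
  ∖-same W β with ≡-dec ℕ._≟_ β β
  ... | yes _   = refl
  ... | no  β≢β = contradiction P.refl β≢β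

  ⟪⟫-peel : ∀ {n} (p : Poly n) W β → ⟪ p ∣ W ⟫ ≈ coeff p β * W β + ⟪ p ∣ W ∖ β ⟫
  ⟪⟫-peel []            W β = sym (trans (+-identityʳ _) (zeroˡ _))
  ⟪⟫-peel ((a , γ) ∷ p) W β with ≡-dec ℕ._≟_ β γ
  ... | yes P.refl = begin
    a * W β + ⟪ p ∣ W ⟫
      ≈⟨ +-congˡ (⟪⟫-peel p W β) ⟩
    a * W β + (coeff p β * W β + ⟪ p ∣ W ∖ β ⟫)
      ≈⟨ solve 4 (λ a w c r → a :* w :+ (c :* w :+ r) := (a :+ c) :* w :+ r) refl a (W β) (coeff p β) _ ⟩
    (a + coeff p β) * W β + ⟪ p ∣ W ∖ β ⟫
      ≈⟨ +-congˡ (trans (+-congʳ (zeroʳ a)) (+-identityˡ _)) ⟨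
    (a + coeff p β) * W β + (a * 0# + ⟪ p ∣ W ∖ β ⟫) ∎
  ... | no  _ = begin
    a * W γ + ⟪ p ∣ W ⟫
      ≈⟨ +-congˡ (⟪⟫-peel p W β) ⟩
    a * W γ + (coeff p β * W β + ⟪ p ∣ W ∖ β ⟫)
      ≈⟨ solve 4 (λ x c w r → x :+ (c :* w :+ r) := c :* w :+ (x :+ r)) refl (a * W γ) (coeff p β) (W β) _ ⟩
    coeff p β * W β + (a * W γ + ⟪ p ∣ W ∖ β ⟫) ∎

  -- Without decidable equality in K, cancellations among equal monomials of p can only be
  -- regrouped under double negation.
  ⟪⟫≈0-if-supports-disjoint : ∀ {n} (p : Poly n) W → (∀ γ → ¬ ¬ (coeff p γ ≈ 0# ⊎ W γ ≈ 0#)) →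
                              ¬ ¬ (⟪ p ∣ W ⟫ ≈ 0#)
  ⟪⟫≈0-if-supports-disjoint []            W _   = λ ¬0≈0 → ¬0≈0 refl
  ⟪⟫≈0-if-supports-disjoint ((a , β) ∷ p) W disjoint =
    ¬¬-zipWith combine (disjoint β) (⟪⟫≈0-if-supports-disjoint p (W ∖ β) disjoint′)
    where
    open RawMonad ¬¬-Monad using () renaming (zipWith to ¬¬-zipWith)

    combine : coeff ((a , β) ∷ p) β ≈ 0# ⊎ W β ≈ 0# → ⟪ p ∣ W ∖ β ⟫ ≈ 0# → ⟪ (a , β) ∷ p ∣ W ⟫ ≈ 0#
    combine cβ⊎Wβ p≈0 = begin
      ⟪ (a , β) ∷ p ∣ W ⟫
        ≈⟨ ⟪⟫-peel ((a , β) ∷ p) W β ⟩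
      coeff ((a , β) ∷ p) β * W β + (a * (W ∖ β) β + ⟪ p ∣ W ∖ β ⟫)
        ≈⟨ +-cong (product≈0 cβ⊎Wβ) (+-cong (trans (*-congˡ (∖-same W β)) (zeroʳ a)) p≈0) ⟩
      0# + (0# + 0#)
        ≈⟨ trans (+-identityˡ _) (+-identityˡ _) ⟩
      0# ∎
      where
      product≈0 : coeff ((a , β) ∷ p) β ≈ 0# ⊎ W β ≈ 0# → coeff ((a , β) ∷ p) β * W β ≈ 0#
      product≈0 (inj₁ c≈0) = trans (*-congʳ c≈0) (zeroˡ _)
      product≈0 (inj₂ w≈0) = trans (*-congˡ w≈0) (zeroʳ _)

    disjoint′ : ∀ γ → ¬ ¬ (coeff p γ ≈ 0# ⊎ (W ∖ β) γ ≈ 0#)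
    disjoint′ γ with ≡-dec ℕ._≟_ β γ
    ... | yes P.refl = λ ¬∖≈0 → ¬∖≈0 (inj₂ refl)
    ... | no  β≢γ    = ¬¬-map [ inj₁ ∘ trans (sym coeff-γ) , inj₂ ]′ (disjoint γ)
      where
      coeff-γ : coeff ((a , β) ∷ p) γ ≈ coeff p γ
      coeff-γ = trans (coeff-∷ a β p γ)
        (trans (+-congʳ (trans (*-congʳ (δ-≢ (≡-dec ℕ._≟_) γ β (β≢γ ∘ P.sym))) (zeroˡ a))) (+-identityˡ _))

  ¬Appears-if-isolated : ∀ {n} (f : Poly n) α W → W α ≈ 1# → (∀ γ → Appears f γ → γ ≢ α → W γ ≈ 0#) →
                         ⟪ f ∣ W ⟫ ≈ 0# → ¬ Appears f α
  ¬Appears-if-isolated f α W Wα≈1 W-isolates f⊥W f-has-α =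
    ⟪⟫≈0-if-supports-disjoint f (W ∖ α) disjoint (λ rest≈0 → f-has-α (coeff≈0 rest≈0))
    where
    disjoint : ∀ γ → ¬ ¬ (coeff f γ ≈ 0# ⊎ (W ∖ α) γ ≈ 0#)
    disjoint γ with ≡-dec ℕ._≟_ α γ
    ... | yes P.refl = λ ¬∖≈0 → ¬∖≈0 (inj₂ refl)
    ... | no  α≢γ    = ¬¬-map by-cases ¬¬-excluded-middle
      where
      by-cases : Dec (coeff f γ ≈ 0#) → coeff f γ ≈ 0# ⊎ W γ ≈ 0#
      by-cases (yes fγ≈0)    = inj₁ fγ≈0
      by-cases (no  f-has-γ) = inj₂ (W-isolates γ f-has-γ (α≢γ ∘ P.sym))

    coeff≈0 : ⟪ f ∣ W ∖ α ⟫ ≈ 0# → coeff f α ≈ 0#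
    coeff≈0 rest≈0 = begin
      coeff f α                        ≈⟨ *-identityʳ _ ⟨
      coeff f α * 1#                   ≈⟨ *-congˡ Wα≈1 ⟨
      coeff f α * W α                  ≈⟨ +-identityʳ _ ⟨
      coeff f α * W α + 0#             ≈⟨ +-congˡ rest≈0 ⟨
      coeff f α * W α + ⟪ f ∣ W ∖ α ⟫  ≈⟨ ⟪⟫-peel f W α ⟨
      ⟪ f ∣ W ⟫                        ≈⟨ f⊥W ⟩
      0#                               ∎

-- Only now: inside Duality, _+_ is the addition of 𝕂.
open import Data.Nat using (_+_)

theorem7p2 : ∀ {c ℓ : Level} (𝕂 : Field c ℓ) → let open FieldDefs 𝕂 in
    (n : ℕ) (S : Fin n → Multiset) (f : Poly n) (α λ' : Vec ℕ n) →
    (∀ i → IsNull (lookup λ' i) (S i)) →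
    (∀ i → lookup α i < ‖ S i ‖) →
    Appears f α →
    (∀ γ → Appears f γ → ¬ (γ ≡ α) →
      ∃ λ (i : Fin n) →
        (lookup γ i < lookup α i)
        ⊎ ((lookup α i + 1 ≤ lookup γ i × lookup γ i < ‖ S i ‖)
        ⊎ lookup γ i ∈[ ‖ S i ‖ , lookup α i + lookup λ' i ])) →
    ¬ VanishesOn f S
theorem7p2 𝕂 n S f α λ' S-null α<‖S‖ f-has-α isolated f-vanishes =
  ¬Appears-if-isolated f α (⨂ φ) (⨂-one φ α (λ i → Dual.φ-at-a i)) φ-isolates ⟪f∣⨂φ⟫≈0 f-has-α
  where
  open Field 𝕂 using (_≈_; 0#)
  open FieldDefs 𝕂
  open Duality 𝕂
  module Dual i = DualSequence (S i) (lookup α i) (lookup λ' i) (S-null i) (α<‖S‖ i)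

  φ : Fin n → Seq
  φ i = Dual.φ i

  ⟪f∣⨂φ⟫≈0 : ⟪ f ∣ ⨂ φ ⟫ ≈ 0#
  ⟪f∣⨂φ⟫≈0 = ⟪⟫-⨂-replace f (HasseFunctional ∘ S) φ (λ i → Dual.φ-dominated i)
                           (vanishes⇒⟪⟫-hasse≈0 S f f-vanishes)

  φ-isolates : ∀ γ → Appears f γ → γ ≢ α → ⨂ φ γ ≈ 0#
  φ-isolates γ f-has-γ γ≢α with isolated γ f-has-γ γ≢α
  ... | i , γᵢ-in-gap = ⨂-zero φ i γ (Dual.φ-vanishes i (lookup γ i) γᵢ-in-gap)
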